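{- For every $n\ge 1$, the number of permutations of $[n]$ containing exactly two occurrences of the pattern $2\text{ - }13$ equals $$\frac{n(n-3)}{2(n+4)}\binom{2n}{n-3}$$ (with $\binom{2n}{n-3}=0$ when $n<3$).
   Context: An occurrence of the pattern $2\text{ - }13$ in a permutation $a_1a_2\cdots a_n$ is a pair of indices $(i,j)$ with $1\le i<j<n$ such that $a_j<a_i<a_{j+1}$. -}

module Defs where

open import Data.Nat using (ℕ; zero; suc; _+_; _<_; _<ᵇ_)
open import Data.Nat.Properties using (_≟_)
open import Data.Bool using (Bool; true; false; _∧_; if_then_else_)
open import Data.Fin using (Fin; toℕ)
import Data.Fin.Properties as FinP
open import Data.List using (List; []; _∷_; [_]; map; concatMap; allFin; filter; length)
open import Data.Vec using (Vec; toList)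
import Data.Vec as Vec
open import Relation.Binary.PropositionalEquality using (_≡_)
open import Data.Product using (_×_)
open import Relation.Nullary.Decidable using (Dec; _×-dec_)
import Data.List.Relation.Unary.Unique.DecPropositional as UniqueDec

-- We represent a word over [n] of length n as a Vec (Fin n) n, the
-- letter (i : Fin n) standing for the value toℕ i + 1 ∈ [n].

oneLine : ∀ {n} → Vec (Fin n) n → List ℕ
oneLine w = map (λ i → suc (toℕ i)) (toList w)

IsPermutation : ∀ {n} → Vec (Fin n) n → Set
IsPermutation w = UniqueDec.Unique FinP._≟_ (toList w)

allWords : (m k : ℕ) → List (Vec (Fin m) k)
allWords m zero    = [ Vec.[] ]
allWords m (suc k) = concatMap (λ x → map (x Vec.∷_) (allWords m k)) (allFin m)

-- Occurrences of the pattern 2-13 in a₁⋯aₙ: pairs (i,j), 1 ≤ i < j < n,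
-- with a_j < a_i < a_{j+1}.
-- cnt x (b₁ b₂ ⋯ bₖ) = #{ j : 1 ≤ j < k , b_j < x < b_{j+1} }
cnt : ℕ → List ℕ → ℕ
cnt x []            = 0
cnt x (y ∷ [])      = 0
cnt x (y ∷ z ∷ r)   = (if (y <ᵇ x) ∧ (x <ᵇ z) then 1 else 0) + cnt x (z ∷ r)

occ213 : List ℕ → ℕ
occ213 []       = 0
occ213 (x ∷ xs) = cnt x xs + occ213 xs

HasExactlyTwo213 : ∀ {n} → Vec (Fin n) n → Set
HasExactlyTwo213 w = occ213 (oneLine w) ≡ 2

isCounted? : ∀ {n} (w : Vec (Fin n) n) → Dec (IsPermutation w × HasExactlyTwo213 w)
isCounted? w = UniqueDec.unique? FinP._≟_ (toList w) ×-dec (occ213 (oneLine w) ≟ 2)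

numPermsTwo213 : ℕ → ℕ
numPermsTwo213 n = length (filter isCounted? (allWords n n))

module Submission where

-- Appending a last value y to a permutation of [n] that ends in ℓ (its values ≥ y being shifted
-- up by one) creates one new occurrence of 2-13 for each value strictly between ℓ and y, that is
-- (y - ℓ - 1)⁺ of them.  Hence the number t(n, x, c) of permutations of [n] that end in x and
-- contain c occurrences satisfies t(n + 1, x, c) = Σ_ℓ t(n, ℓ, c - (x - ℓ - 1)⁺).  For c ≤ 2,
-- twice the number of such permutations whose last value exceeds x is a combination of the
-- binomials C(2n - x - 1, n - 4 + j) with coefficients polynomial in x and n.  That these closed
-- forms obey the recurrence comes down to a handful of binomial identities, each certified by
-- rescaling its binomials to a common one, which leaves a polynomial identity for the ring
-- solver.  At c = 2 and x = 0 the closed form counts all permutations with two occurrences, and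
-- one more such identity turns it into the stated formula.

open import Defs
open import Data.Bool using (Bool; true; false; T; _∧_; if_then_else_)
open import Data.Bool.Properties using (∧-zeroʳ; T-∧)
open import Data.Empty using (⊥-elim)
open import Data.Fin as Fin using (Fin; zero; suc; toℕ; punchIn)
import Data.Fin.Properties as Fin
open import Data.List as List using (List; []; _∷_; _++_; [_]; map; concatMap; allFin; tabulate; filter; length)
import Data.List.Properties as List
open import Data.List.Relation.Unary.All as All using (All; all?; []; _∷_)
import Data.List.Relation.Unary.All.Properties as All
open import Data.List.Relation.Unary.AllPairs using ([]; _∷_)
import Data.List.Relation.Unary.Unique.DecPropositional as UniqueDec
import Data.List.Relation.Unary.Unique.Propositional.Properties as Unique
open import Data.Nat as ℕ using (ℕ; zero; suc; _≤_; _<_; _∸_; _≥_; _<ᵇ_; _≤ᵇ_; _⊔_; z≤n; s≤s)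
import Data.Nat.Properties as ℕ
import Data.Nat.Tactic.RingSolver as ℕ-Solver
open import Data.Nat.Combinatorics using (_C_; nC1≡n; nCk+nC[k+1]≡[n+1]C[k+1])
open import Algebra.Properties.CommutativeMonoid.Sum ℕ.+-0-commutativeMonoid
  using (sum; sum-syntax; sum-remove; ∑-distrib-+; sum-cong-≗; sum-replicate-zero)
import Data.Integer as ℤ
import Data.Integer.Properties as ℤ
open import Data.Product using (_×_; _,_; proj₁; proj₂)
open import Data.Vec as Vec using (Vec; toList; _∷ʳ_)
import Data.Vec.Properties as Vec
open import Function using (_∘_; id)
open import Function.Bundles using (_⇔_; mk⇔; Equivalence)
open import Relation.Binary.PropositionalEquality hiding ([_])
open import Relation.Nullary using (Dec; yes; no; does; ¬?)
open import Relation.Nullary.Decidable using (_×-dec_; dec-true; dec-false; does-⇔)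

module Counting where

  open import Data.Nat using (_+_; _*_)
  open import Algebra.Properties.CommutativeSemigroup ℕ.+-commutativeSemigroup using (interchange)
  open import Algebra.Properties.CommutativeSemigroup ℕ.*-commutativeSemigroup
    using (x∙yz≈yx∙z; xy∙z≈y∙xz)
  open ≡-Reasoning

  𝟙 : Bool → ℕ
  𝟙 b = if b then 1 else 0

  χ : ∀ {p} {P : Set p} → Dec P → ℕ
  χ = 𝟙 ∘ does

  𝟙-∧ : ∀ a b → 𝟙 (a ∧ b) ≡ 𝟙 a * 𝟙 b
  𝟙-∧ true  b = sym (ℕ.+-identityʳ (𝟙 b))
  𝟙-∧ false b = refl

  χ-≟-sym : ∀ m n → χ (m ℕ.≟ n) ≡ χ (n ℕ.≟ m)
  χ-≟-sym m n = cong 𝟙 (does-⇔ (mk⇔ sym sym) (m ℕ.≟ n) (n ℕ.≟ m))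

  χ-+-≟ : ∀ o k c → χ (o + k ℕ.≟ c) ≡ χ (k ℕ.≤? c) * χ (o ℕ.≟ c ∸ k)
  χ-+-≟ o k c = split (k ℕ.≤? c)
    where
    split : (k≤?c : Dec (k ≤ c)) → χ (o + k ℕ.≟ c) ≡ χ k≤?c * χ (o ℕ.≟ c ∸ k)
    split (yes k≤c) =
      trans (cong 𝟙 (does-⇔ (mk⇔ to from) (o + k ℕ.≟ c) (o ℕ.≟ c ∸ k))) (sym (ℕ.+-identityʳ _))
      where
      to : o + k ≡ c → o ≡ c ∸ k
      to eq = trans (sym (ℕ.m+n∸n≡m o k)) (cong (_∸ k) eq)
      from : o ≡ c ∸ k → o + k ≡ c
      from eq = trans (cong (_+ k) eq) (ℕ.m∸n+n≡m k≤c)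
    split (no k≰c) = cong 𝟙 (dec-false (o + k ℕ.≟ c) (λ eq → k≰c (subst (k ≤_) eq (ℕ.m≤n+m k o))))

  ∑ : ∀ {a} {A : Set a} → List A → (A → ℕ) → ℕ
  ∑ []       f = 0
  ∑ (x ∷ xs) f = f x + ∑ xs f

  infixl 10 ∑
  syntax ∑ xs (λ x → e) = ∑[ x ∈ xs ] e

  module _ {a} {A : Set a} where

    ∑-cong : ∀ xs {f g : A → ℕ} → (∀ x → f x ≡ g x) → ∑ xs f ≡ ∑ xs g
    ∑-cong []       f≗g = refl
    ∑-cong (x ∷ xs) f≗g = cong₂ _+_ (f≗g x) (∑-cong xs f≗g)

    ∑-++ : ∀ xs ys (f : A → ℕ) → ∑ (xs ++ ys) f ≡ ∑ xs f + ∑ ys f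
    ∑-++ []       ys f = refl
    ∑-++ (x ∷ xs) ys f = trans (cong (f x +_) (∑-++ xs ys f)) (sym (ℕ.+-assoc (f x) _ _))

    ∑-*ˡ : ∀ xs k (f : A → ℕ) → ∑[ x ∈ xs ] (k * f x) ≡ k * ∑ xs f
    ∑-*ˡ []       k f = sym (ℕ.*-zeroʳ k)
    ∑-*ˡ (x ∷ xs) k f = trans (cong (k * f x +_) (∑-*ˡ xs k f)) (sym (ℕ.*-distribˡ-+ k (f x) _))

    ∑-*ʳ : ∀ xs k (f : A → ℕ) → ∑[ x ∈ xs ] (f x * k) ≡ ∑ xs f * k
    ∑-*ʳ []       k f = refl
    ∑-*ʳ (x ∷ xs) k f = trans (cong (f x * k +_) (∑-*ʳ xs k f)) (sym (ℕ.*-distribʳ-+ k (f x) _))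

    ∑-const : ∀ (xs : List A) → ∑ xs (λ _ → 1) ≡ length xs
    ∑-const []       = refl
    ∑-const (x ∷ xs) = cong suc (∑-const xs)

    ∑-swap : ∀ xs n (f : A → Fin n → ℕ) →
      ∑[ x ∈ xs ] ∑[ i < n ] f x i ≡ ∑[ i < n ] ∑[ x ∈ xs ] f x i
    ∑-swap []       n f = sym (sum-replicate-zero n)
    ∑-swap (x ∷ xs) n f = trans (cong (sum (f x) +_) (∑-swap xs n f)) (sym (∑-distrib-+ (f x) _))

  module _ {a b} {A : Set a} {B : Set b} where

    ∑-map : ∀ (g : A → B) xs f → ∑ (map g xs) f ≡ ∑[ x ∈ xs ] f (g x)
    ∑-map g []       f = refl
    ∑-map g (x ∷ xs) f = cong (f (g x) +_) (∑-map g xs f)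

    ∑-concatMap : ∀ (g : A → List B) xs f → ∑ (concatMap g xs) f ≡ ∑[ x ∈ xs ] ∑ (g x) f
    ∑-concatMap g []       f = refl
    ∑-concatMap g (x ∷ xs) f =
      trans (∑-++ (g x) (concatMap g xs) f) (cong (∑ (g x) f +_) (∑-concatMap g xs f))

  length-filter : ∀ {a p} {A : Set a} {P : A → Set p} (P? : ∀ x → Dec (P x)) xs →
    length (filter P? xs) ≡ ∑[ x ∈ xs ] χ (P? x)
  length-filter P? []       = refl
  length-filter P? (x ∷ xs) with does (P? x)
  ... | true  = cong suc (length-filter P? xs)
  ... | false = length-filter P? xs

  ∑-allFin : ∀ n (f : Fin n → ℕ) → ∑ (allFin n) f ≡ ∑[ i < n ] f i
  ∑-allFin n f = go n id
    where
    go : ∀ m (g : Fin m → Fin n) → ∑ (tabulate g) f ≡ ∑[ i < m ] f (g i)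
    go zero    g = refl
    go (suc m) g = cong (f (g zero) +_) (go m (g ∘ suc))

  ∑-punchIn : ∀ m (y : Fin (suc m)) (g : Fin (suc m) → ℕ) →
    ∑[ x < suc m ] (χ (¬? (x Fin.≟ y)) * g x) ≡ ∑[ z < m ] g (punchIn y z)
  ∑-punchIn m y g = begin
    ∑[ x < suc m ] (χ (¬? (x Fin.≟ y)) * g x)
      ≡⟨ sum-remove {i = y} (λ x → χ (¬? (x Fin.≟ y)) * g x) ⟩
    χ (¬? (y Fin.≟ y)) * g y + ∑[ z < m ] (χ (¬? (punchIn y z Fin.≟ y)) * g (punchIn y z))
      ≡⟨ cong₂ _+_ (cong (λ b → 𝟙 b * g y) (dec-false (¬? (y Fin.≟ y)) λ y≢y → y≢y refl))
                   (sum-cong-≗ λ z → cong (λ b → 𝟙 b * g (punchIn y z))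
                                           (dec-true (¬? (punchIn y z Fin.≟ y)) (Fin.punchInᵢ≢i y z))) ⟩
    ∑[ z < m ] (1 * g (punchIn y z))
      ≡⟨ sum-cong-≗ (λ z → ℕ.*-identityˡ (g (punchIn y z))) ⟩
    ∑[ z < m ] g (punchIn y z) ∎

  ∑-delta : ∀ n (y : Fin n) (g : Fin n → ℕ) → ∑[ x < n ] (χ (x Fin.≟ y) * g x) ≡ g y
  ∑-delta (suc m) y g = begin
    ∑[ x < suc m ] (χ (x Fin.≟ y) * g x)
      ≡⟨ sum-remove {i = y} (λ x → χ (x Fin.≟ y) * g x) ⟩
    χ (y Fin.≟ y) * g y + ∑[ z < m ] (χ (punchIn y z Fin.≟ y) * g (punchIn y z))
      ≡⟨ cong₂ _+_ (cong (λ b → 𝟙 b * g y) (dec-true (y Fin.≟ y) refl))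
                   (sum-cong-≗ λ z → cong (λ b → 𝟙 b * g (punchIn y z))
                                           (dec-false (punchIn y z Fin.≟ y) (Fin.punchInᵢ≢i y z))) ⟩
    1 * g y + ∑[ z < m ] 0
      ≡⟨ cong₂ _+_ (ℕ.*-identityˡ (g y)) (sum-replicate-zero m) ⟩
    g y + 0
      ≡⟨ ℕ.+-identityʳ (g y) ⟩
    g y ∎

  ∑-delta-toℕ : ∀ N x → x < N → (g : ℕ → ℕ) →
    ∑[ y < N ] (χ (toℕ y ℕ.≟ x) * g (toℕ y)) ≡ g x
  ∑-delta-toℕ N x x<N g = begin
    ∑[ y < N ] (χ (toℕ y ℕ.≟ x) * g (toℕ y))
      ≡⟨ sum-cong-≗ (λ y → cong (λ b → 𝟙 b * g (toℕ y)) (same y)) ⟩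
    ∑[ y < N ] (χ (y Fin.≟ x̂) * g (toℕ y))
      ≡⟨ ∑-delta N x̂ (g ∘ toℕ) ⟩
    g (toℕ x̂)
      ≡⟨ cong g (Fin.toℕ-fromℕ< x<N) ⟩
    g x ∎
    where
    x̂ = Fin.fromℕ< x<N
    same : ∀ y → does (toℕ y ℕ.≟ x) ≡ does (y Fin.≟ x̂)
    same y = does-⇔ (mk⇔ (λ eq → Fin.toℕ-injective (trans eq (sym (Fin.toℕ-fromℕ< x<N))))
                         (λ eq → trans (cong toℕ eq) (Fin.toℕ-fromℕ< x<N)))
                    (toℕ y ℕ.≟ x) (y Fin.≟ x̂)

  ∑-allWords-suc : ∀ m k (f : Vec (Fin m) (suc k) → ℕ) →
    ∑ (allWords m (suc k)) f ≡ ∑[ x < m ] ∑[ v ∈ allWords m k ] f (x Vec.∷ v)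
  ∑-allWords-suc m k f = begin
    ∑ (concatMap (λ x → map (x Vec.∷_) (allWords m k)) (allFin m)) f
      ≡⟨ ∑-concatMap (λ x → map (x Vec.∷_) (allWords m k)) (allFin m) f ⟩
    ∑[ x ∈ allFin m ] ∑ (map (x Vec.∷_) (allWords m k)) f
      ≡⟨ ∑-cong (allFin m) (λ x → ∑-map (x Vec.∷_) (allWords m k) f) ⟩
    ∑[ x ∈ allFin m ] ∑[ v ∈ allWords m k ] f (x Vec.∷ v)
      ≡⟨ ∑-allFin m (λ x → ∑[ v ∈ allWords m k ] f (x Vec.∷ v)) ⟩
    ∑[ x < m ] ∑[ v ∈ allWords m k ] f (x Vec.∷ v) ∎

  allWords-snoc : ∀ m k (f : Vec (Fin m) (suc k) → ℕ) →
    ∑ (allWords m (suc k)) f ≡ ∑[ w ∈ allWords m k ] ∑[ y < m ] f (w ∷ʳ y)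
  allWords-snoc m zero    f = begin
    ∑ (allWords m 1) f                  ≡⟨ ∑-allWords-suc m 0 f ⟩
    ∑[ y < m ] (f (y Vec.∷ Vec.[]) + 0) ≡⟨ sum-cong-≗ (λ y → ℕ.+-identityʳ (f (y Vec.∷ Vec.[]))) ⟩
    ∑[ y < m ] f (y Vec.∷ Vec.[])       ≡⟨ ℕ.+-identityʳ _ ⟨
    ∑[ y < m ] f (y Vec.∷ Vec.[]) + 0   ∎
  allWords-snoc m (suc k) f = begin
    ∑ (allWords m (suc (suc k))) f
      ≡⟨ ∑-allWords-suc m (suc k) f ⟩
    ∑[ x < m ] ∑[ v ∈ allWords m (suc k) ] f (x Vec.∷ v)
      ≡⟨ sum-cong-≗ (λ x → allWords-snoc m k (f ∘ (x Vec.∷_))) ⟩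
    ∑[ x < m ] ∑[ w ∈ allWords m k ] ∑[ y < m ] f ((x Vec.∷ w) ∷ʳ y)
      ≡⟨ ∑-allWords-suc m k (λ w → ∑[ y < m ] f (w ∷ʳ y)) ⟨
    ∑[ w ∈ allWords m (suc k) ] ∑[ y < m ] f (w ∷ʳ y) ∎

  avoids? : ∀ {m k} (y : Fin m) (w : Vec (Fin m) k) → Dec (All (_≢ y) (toList w))
  avoids? y w = all? (λ x → ¬? (x Fin.≟ y)) (toList w)

  allWords-avoiding : ∀ m k (y : Fin (suc m)) (f : Vec (Fin (suc m)) k → ℕ) →
    ∑[ w ∈ allWords (suc m) k ] (χ (avoids? y w) * f w)
    ≡ ∑[ w ∈ allWords m k ] f (Vec.map (punchIn y) w)
  allWords-avoiding m zero    y f = cong (_+ 0) (ℕ.*-identityˡ (f Vec.[]))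
  allWords-avoiding m (suc k) y f = begin
    ∑[ w ∈ allWords (suc m) (suc k) ] (χ (avoids? y w) * f w)
      ≡⟨ ∑-allWords-suc (suc m) k (λ w → χ (avoids? y w) * f w) ⟩
    ∑[ x < suc m ] ∑[ v ∈ allWords (suc m) k ] (χ (avoids? y (x Vec.∷ v)) * f (x Vec.∷ v))
      ≡⟨ sum-cong-≗ split ⟩
    ∑[ x < suc m ] (χ (¬? (x Fin.≟ y)) * rest x)
      ≡⟨ ∑-punchIn m y rest ⟩
    ∑[ z < m ] rest (punchIn y z)
      ≡⟨ sum-cong-≗ (λ z → allWords-avoiding m k y (f ∘ (punchIn y z Vec.∷_))) ⟩
    ∑[ z < m ] ∑[ v ∈ allWords m k ] f (Vec.map (punchIn y) (z Vec.∷ v))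
      ≡⟨ ∑-allWords-suc m k (f ∘ Vec.map (punchIn y)) ⟨
    ∑[ w ∈ allWords m (suc k) ] f (Vec.map (punchIn y) w) ∎
    where
    rest : Fin (suc m) → ℕ
    rest x = ∑[ v ∈ allWords (suc m) k ] (χ (avoids? y v) * f (x Vec.∷ v))
    split : ∀ x → ∑[ v ∈ allWords (suc m) k ] (χ (avoids? y (x Vec.∷ v)) * f (x Vec.∷ v))
                ≡ χ (¬? (x Fin.≟ y)) * rest x
    split x = trans (∑-cong (allWords (suc m) k) (λ v →
        trans (cong (_* f (x Vec.∷ v)) (𝟙-∧ (does (¬? (x Fin.≟ y))) (does (avoids? y v))))
              (ℕ.*-assoc (χ (¬? (x Fin.≟ y))) (χ (avoids? y v)) (f (x Vec.∷ v)))))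
      (∑-*ˡ (allWords (suc m) k) (χ (¬? (x Fin.≟ y))) (λ v → χ (avoids? y v) * f (x Vec.∷ v)))

  module _ {m : ℕ} where

    Distinct : List (Fin m) → Set
    Distinct = UniqueDec.Unique Fin._≟_

    distinct? : ∀ {k} (w : Vec (Fin m) k) → Dec (Distinct (toList w))
    distinct? w = UniqueDec.unique? Fin._≟_ (toList w)

    distinct-snoc : ∀ xs (y : Fin m) → Distinct (xs ++ [ y ]) ⇔ (Distinct xs × All (_≢ y) xs)
    distinct-snoc xs y = mk⇔ (to xs) (from xs)
      where
      to : ∀ xs → Distinct (xs ++ [ y ]) → Distinct xs × All (_≢ y) xs
      to []       _          = [] , []
      to (x ∷ xs) (x∉ ∷ xs!) =
        let xs! , xs≢y = to xs xs! in All.++⁻ˡ xs x∉ ∷ xs! , All.head (All.++⁻ʳ xs x∉) ∷ xs≢y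
      from : ∀ xs → Distinct xs × All (_≢ y) xs → Distinct (xs ++ [ y ])
      from []       _                       = [] ∷ []
      from (x ∷ xs) (x∉ ∷ xs! , x≢y ∷ xs≢y) = All.++⁺ x∉ (x≢y ∷ []) ∷ from xs (xs! , xs≢y)

    χ-distinct-snoc : ∀ {k} (w : Vec (Fin m) k) y →
      χ (distinct? (w ∷ʳ y)) ≡ χ (distinct? w) * χ (avoids? y w)
    χ-distinct-snoc w y = begin
      χ (distinct? (w ∷ʳ y))
        ≡⟨ cong (χ ∘ UniqueDec.unique? Fin._≟_) (Vec.toList-∷ʳ y w) ⟩
      χ (UniqueDec.unique? Fin._≟_ (toList w ++ [ y ]))
        ≡⟨ cong 𝟙 (does-⇔ (distinct-snoc (toList w) y)
                          (UniqueDec.unique? Fin._≟_ (toList w ++ [ y ])) (distinct? w ×-dec avoids? y w)) ⟩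
      𝟙 (does (distinct? w) ∧ does (avoids? y w))
        ≡⟨ 𝟙-∧ (does (distinct? w)) (does (avoids? y w)) ⟩
      χ (distinct? w) * χ (avoids? y w) ∎

  χ-distinct-punchIn : ∀ {m k} (y : Fin (suc m)) (w : Vec (Fin m) k) →
    χ (distinct? (Vec.map (punchIn y) w)) ≡ χ (distinct? w)
  χ-distinct-punchIn y w = cong 𝟙 (does-⇔ (mk⇔ to from) (distinct? (Vec.map (punchIn y) w)) (distinct? w))
    where
    to : Distinct (toList (Vec.map (punchIn y) w)) → Distinct (toList w)
    to d = Unique.map⁻ (subst Distinct (Vec.toList-map (punchIn y) w) d)
    from : Distinct (toList w) → Distinct (toList (Vec.map (punchIn y) w))
    from d = subst Distinct (sym (Vec.toList-map (punchIn y) w))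
                   (Unique.map⁺ (Fin.punchIn-injective y _ _) d)

  multiplicity : ∀ {N} → Fin N → List (Fin N) → ℕ
  multiplicity v xs = ∑[ z ∈ xs ] χ (v Fin.≟ z)

  ∑-by-multiplicity : ∀ {N} (xs : List (Fin N)) g → ∑ xs g ≡ ∑[ v < N ] (multiplicity v xs * g v)
  ∑-by-multiplicity {N} xs g = begin
    ∑ xs g
      ≡⟨ ∑-cong xs (λ z → sym (∑-delta N z g)) ⟩
    ∑[ z ∈ xs ] ∑[ v < N ] (χ (v Fin.≟ z) * g v)
      ≡⟨ ∑-swap xs N (λ z v → χ (v Fin.≟ z) * g v) ⟩
    ∑[ v < N ] ∑[ z ∈ xs ] (χ (v Fin.≟ z) * g v)
      ≡⟨ sum-cong-≗ (λ v → ∑-*ʳ xs (g v) (λ z → χ (v Fin.≟ z))) ⟩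
    ∑[ v < N ] (multiplicity v xs * g v) ∎

  multiplicity-∉ : ∀ {N} (v : Fin N) xs → All (v ≢_) xs → multiplicity v xs ≡ 0
  multiplicity-∉ v []       []           = refl
  multiplicity-∉ v (z ∷ xs) (v≢z ∷ v∉xs) with v Fin.≟ z
  ... | yes v≡z = ⊥-elim (v≢z v≡z)
  ... | no  _   = multiplicity-∉ v xs v∉xs

  multiplicity≤1 : ∀ {N} (v : Fin N) xs → Distinct xs → multiplicity v xs ≤ 1
  multiplicity≤1 v []       []          = z≤n
  multiplicity≤1 v (z ∷ xs) (z∉xs ∷ xs!) with v Fin.≟ z
  ... | yes refl = ℕ.≤-reflexive (cong suc (multiplicity-∉ v xs z∉xs))
  ... | no  _    = multiplicity≤1 v xs xs!

  all-ones : ∀ N (f : Fin N → ℕ) → (∀ v → f v ≤ 1) → ∑[ v < N ] f v ≡ N → ∀ v → f v ≡ 1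
  all-ones (suc N) f f≤1 sum≡ v with f zero in f₀ | f≤1 zero
  ... | 0           | _         =
    ⊥-elim (ℕ.<-irrefl refl (subst (_≤ N) sum≡ (bounded N (f ∘ suc) (f≤1 ∘ suc))))
    where
    bounded : ∀ N (g : Fin N → ℕ) → (∀ v → g v ≤ 1) → ∑[ v < N ] g v ≤ N
    bounded zero    g g≤1 = z≤n
    bounded (suc N) g g≤1 = ℕ.+-mono-≤ (g≤1 zero) (bounded N (g ∘ suc) (g≤1 ∘ suc))
  ... | suc (suc _) | s≤s ()
  ... | 1           | _ with v
  ...   | zero   = f₀
  ...   | suc v′ = all-ones N (f ∘ suc) (f≤1 ∘ suc) (ℕ.suc-injective sum≡) v′

  ∑-permutation : ∀ {N} (w : Vec (Fin N) N) → Distinct (toList w) →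
    ∀ g → ∑ (toList w) g ≡ ∑[ v < N ] g v
  ∑-permutation {N} w w! g = begin
    ∑ (toList w) g                                ≡⟨ ∑-by-multiplicity (toList w) g ⟩
    ∑[ v < N ] (multiplicity v (toList w) * g v)  ≡⟨ sum-cong-≗ (λ v → cong (_* g v) (once v)) ⟩
    ∑[ v < N ] (1 * g v)                          ≡⟨ sum-cong-≗ (λ v → ℕ.*-identityˡ (g v)) ⟩
    ∑[ v < N ] g v                                ∎
    where
    total : ∑[ v < N ] multiplicity v (toList w) ≡ N
    total = begin
      ∑[ v < N ] multiplicity v (toList w)
        ≡⟨ sum-cong-≗ (λ v → ℕ.*-identityʳ (multiplicity v (toList w))) ⟨
      ∑[ v < N ] (multiplicity v (toList w) * 1)
        ≡⟨ ∑-by-multiplicity (toList w) (λ _ → 1) ⟨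
      ∑ (toList w) (λ _ → 1)
        ≡⟨ ∑-const (toList w) ⟩
      length (toList w)
        ≡⟨ Vec.length-toList w ⟩
      N ∎
    once : ∀ v → multiplicity v (toList w) ≡ 1
    once = all-ones N (λ v → multiplicity v (toList w)) (λ v → multiplicity≤1 v (toList w) w!) total

  -- Occurrences of 2-13 created by a last letter

  -- oneLine only accepts square words; values is its extension to all words.
  value : ∀ {m} → Fin m → ℕ
  value i = suc (toℕ i)

  values : ∀ {m k} → Vec (Fin m) k → List ℕ
  values w = map value (toList w)

  values-snoc : ∀ {m k} (w : Vec (Fin m) k) y → values (w ∷ʳ y) ≡ values w ++ [ value y ]
  values-snoc w y = trans (cong (map value) (Vec.toList-∷ʳ y w)) (List.map-++ value (toList w) [ y ])

  values-snoc² : ∀ {m k} (v : Vec (Fin m) k) a b →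
    values ((v ∷ʳ a) ∷ʳ b) ≡ values v ++ value a ∷ value b ∷ []
  values-snoc² v a b = begin
    values ((v ∷ʳ a) ∷ʳ b)                   ≡⟨ values-snoc (v ∷ʳ a) b ⟩
    values (v ∷ʳ a) ++ [ value b ]           ≡⟨ cong (_++ [ value b ]) (values-snoc v a) ⟩
    (values v ++ [ value a ]) ++ [ value b ] ≡⟨ List.++-assoc (values v) [ value a ] [ value b ] ⟩
    values v ++ value a ∷ value b ∷ []       ∎

  newOcc : ℕ → ℕ → ℕ
  newOcc y ℓ = y ∸ suc ℓ

  between : ℕ → ℕ → ℕ → ℕ
  between ℓ b z = 𝟙 ((ℓ <ᵇ z) ∧ (z <ᵇ b))

  cnt-snoc : ∀ x zs ℓ b → cnt x (zs ++ ℓ ∷ b ∷ []) ≡ cnt x (zs ++ [ ℓ ]) + between ℓ b x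
  cnt-snoc x []            ℓ b = ℕ.+-comm (between ℓ b x) 0
  cnt-snoc x (z ∷ [])      ℓ b =
    trans (cong (between z ℓ x +_) (cnt-snoc x [] ℓ b)) (sym (ℕ.+-assoc (between z ℓ x) 0 _))
  cnt-snoc x (z ∷ z′ ∷ zs) ℓ b =
    trans (cong (between z z′ x +_) (cnt-snoc x (z′ ∷ zs) ℓ b))
          (sym (ℕ.+-assoc (between z z′ x) _ _))

  occ-snoc : ∀ zs ℓ b →
    occ213 (zs ++ ℓ ∷ b ∷ []) ≡ occ213 (zs ++ [ ℓ ]) + ∑[ z ∈ zs ] between ℓ b z
  occ-snoc []       ℓ b = refl
  occ-snoc (z ∷ zs) ℓ b = begin
    cnt z (zs ++ ℓ ∷ b ∷ []) + occ213 (zs ++ ℓ ∷ b ∷ [])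
      ≡⟨ cong₂ _+_ (cnt-snoc z zs ℓ b) (occ-snoc zs ℓ b) ⟩
    cnt z (zs ++ [ ℓ ]) + between ℓ b z + (occ213 (zs ++ [ ℓ ]) + ∑[ z′ ∈ zs ] between ℓ b z′)
      ≡⟨ interchange (cnt z (zs ++ [ ℓ ])) (between ℓ b z) (occ213 (zs ++ [ ℓ ])) _ ⟩
    cnt z (zs ++ [ ℓ ]) + occ213 (zs ++ [ ℓ ]) + (between ℓ b z + ∑[ z′ ∈ zs ] between ℓ b z′) ∎

  module _ {a} {A : Set a} (f g : A → ℕ) (same-order : ∀ x y → (f x <ᵇ f y) ≡ (g x <ᵇ g y)) where

    cnt-invariant : ∀ x xs → cnt (f x) (map f xs) ≡ cnt (g x) (map g xs)
    cnt-invariant x []           = refl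
    cnt-invariant x (y ∷ [])     = refl
    cnt-invariant x (y ∷ z ∷ zs) =
      cong₂ (λ b r → 𝟙 b + r) (cong₂ _∧_ (same-order y x) (same-order x z)) (cnt-invariant x (z ∷ zs))

    occ-invariant : ∀ xs → occ213 (map f xs) ≡ occ213 (map g xs)
    occ-invariant []       = refl
    occ-invariant (x ∷ xs) = cong₂ _+_ (cnt-invariant x xs) (occ-invariant xs)

  toℕ-punchIn-< : ∀ {n} (i : Fin (suc n)) (j : Fin n) → toℕ j < toℕ i → toℕ (punchIn i j) ≡ toℕ j
  toℕ-punchIn-< (suc i) zero    _         = refl
  toℕ-punchIn-< (suc i) (suc j) (s≤s j<i) = cong suc (toℕ-punchIn-< i j j<i)

  toℕ≤toℕ-punchIn : ∀ {n} (i : Fin (suc n)) (j : Fin n) → toℕ j ≤ toℕ (punchIn i j)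
  toℕ≤toℕ-punchIn zero    j       = ℕ.n≤1+n (toℕ j)
  toℕ≤toℕ-punchIn (suc i) zero    = z≤n
  toℕ≤toℕ-punchIn (suc i) (suc j) = s≤s (toℕ≤toℕ-punchIn i j)

  punchIn-<ᵇ : ∀ {n} (i : Fin (suc n)) (j k : Fin n) →
    (toℕ (punchIn i j) <ᵇ toℕ (punchIn i k)) ≡ (toℕ j <ᵇ toℕ k)
  punchIn-<ᵇ i j k =
    does-⇔ (mk⇔ cancel mono) (toℕ (punchIn i j) ℕ.<? toℕ (punchIn i k)) (toℕ j ℕ.<? toℕ k)
    where
    cancel : toℕ (punchIn i j) < toℕ (punchIn i k) → toℕ j < toℕ k
    cancel ij<ik = ℕ.≰⇒> λ k≤j → ℕ.<⇒≱ ij<ik (Fin.punchIn-mono-≤ i k j k≤j)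
    mono : toℕ j < toℕ k → toℕ (punchIn i j) < toℕ (punchIn i k)
    mono j<k = ℕ.≰⇒> λ ik≤ij → ℕ.<⇒≱ j<k (Fin.punchIn-cancel-≤ i k j ik≤ij)

  punchIn-<ᵇ-pivot : ∀ {n} (i : Fin (suc n)) (j : Fin n) →
    (toℕ (punchIn i j) <ᵇ toℕ i) ≡ (toℕ j <ᵇ toℕ i)
  punchIn-<ᵇ-pivot i j = does-⇔ (mk⇔ to from) (toℕ (punchIn i j) ℕ.<? toℕ i) (toℕ j ℕ.<? toℕ i)
    where
    to : toℕ (punchIn i j) < toℕ i → toℕ j < toℕ i
    to = ℕ.≤-<-trans (toℕ≤toℕ-punchIn i j)
    from : toℕ j < toℕ i → toℕ (punchIn i j) < toℕ i
    from j<i = subst (_< toℕ i) (sym (toℕ-punchIn-< i j j<i)) j<i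

  occ-punchIn : ∀ {m k} (y : Fin (suc m)) (w : Vec (Fin m) k) →
    occ213 (values (Vec.map (punchIn y) w)) ≡ occ213 (values w)
  occ-punchIn y w = begin
    occ213 (map value (toList (Vec.map (punchIn y) w)))
      ≡⟨ cong (occ213 ∘ map value) (Vec.toList-map (punchIn y) w) ⟩
    occ213 (map value (map (punchIn y) (toList w)))
      ≡⟨ cong occ213 (List.map-∘ (toList w)) ⟨
    occ213 (map (value ∘ punchIn y) (toList w))
      ≡⟨ occ-invariant (value ∘ punchIn y) value (punchIn-<ᵇ y) (toList w) ⟩
    occ213 (map value (toList w)) ∎

  between-punchIn : ∀ {n} (y : Fin (suc n)) (ℓ z : Fin n) →
    between (toℕ (punchIn y ℓ)) (toℕ y) (toℕ (punchIn y z)) ≡ between (toℕ ℓ) (toℕ y) (toℕ z)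
  between-punchIn y ℓ z = cong₂ (λ p q → 𝟙 (p ∧ q)) (punchIn-<ᵇ y ℓ z) (punchIn-<ᵇ-pivot y z)

  between-self : ∀ ℓ y → between ℓ y ℓ ≡ 0
  between-self ℓ y = cong (λ b → 𝟙 (b ∧ (ℓ <ᵇ y))) (dec-false (ℓ ℕ.<? ℓ) (ℕ.n≮n ℓ))

  below-count : ∀ N y → y ≤ N → ∑[ v < N ] 𝟙 (toℕ v <ᵇ y) ≡ y
  below-count N       zero    _         = sum-replicate-zero N
  below-count (suc N) (suc y) (s≤s y≤N) = cong suc (below-count N y y≤N)

  between-count : ∀ N ℓ y → y ≤ N → ∑[ v < N ] between ℓ y (toℕ v) ≡ newOcc y ℓ
  between-count N       ℓ       zero    _         =
    trans (sum-cong-≗ {N} (λ v → cong 𝟙 (∧-zeroʳ (ℓ <ᵇ toℕ v)))) (sum-replicate-zero N)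
  between-count (suc N) zero    (suc y) (s≤s y≤N) = below-count N y y≤N
  between-count (suc N) (suc ℓ) (suc y) (s≤s y≤N) = between-count N ℓ y y≤N

  occ-append : ∀ {n} (w : Vec (Fin (suc n)) (suc n)) (y : Fin (suc (suc n))) → Distinct (toList w) →
    occ213 (values (Vec.map (punchIn y) w ∷ʳ y))
    ≡ occ213 (values w) + newOcc (toℕ y) (toℕ (Vec.last w))
  occ-append {n} w y w! with Vec.initLast w
  ... | ws , ℓ , refl = begin
    occ213 (values (Vec.map (punchIn y) (ws ∷ʳ ℓ) ∷ʳ y))
      ≡⟨ cong (λ v → occ213 (values (v ∷ʳ y))) (Vec.map-∷ʳ (punchIn y) ℓ ws) ⟩
    occ213 (values ((pws ∷ʳ punchIn y ℓ) ∷ʳ y))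
      ≡⟨ cong occ213 (values-snoc² pws (punchIn y ℓ) y) ⟩
    occ213 (values pws ++ value (punchIn y ℓ) ∷ value y ∷ [])
      ≡⟨ occ-snoc (values pws) (value (punchIn y ℓ)) (value y) ⟩
    occ213 (values pws ++ [ value (punchIn y ℓ) ])
      + ∑[ z ∈ values pws ] between (value (punchIn y ℓ)) (value y) z
      ≡⟨ cong₂ _+_ old-occurrences new-occurrences ⟩
    occ213 (values (ws ∷ʳ ℓ)) + newOcc (toℕ y) (toℕ ℓ) ∎
    where
    pws = Vec.map (punchIn y) ws
    old-occurrences : occ213 (values pws ++ [ value (punchIn y ℓ) ]) ≡ occ213 (values (ws ∷ʳ ℓ))
    old-occurrences = begin
      occ213 (values pws ++ [ value (punchIn y ℓ) ])
        ≡⟨ cong occ213 (values-snoc pws (punchIn y ℓ)) ⟨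
      occ213 (values (pws ∷ʳ punchIn y ℓ))
        ≡⟨ cong (occ213 ∘ values) (Vec.map-∷ʳ (punchIn y) ℓ ws) ⟨
      occ213 (values (Vec.map (punchIn y) (ws ∷ʳ ℓ)))
        ≡⟨ occ-punchIn y (ws ∷ʳ ℓ) ⟩
      occ213 (values (ws ∷ʳ ℓ)) ∎
    g : Fin (suc n) → ℕ
    g z = between (toℕ ℓ) (toℕ y) (toℕ z)
    new-occurrences :
      ∑[ z ∈ values pws ] between (value (punchIn y ℓ)) (value y) z ≡ newOcc (toℕ y) (toℕ ℓ)
    new-occurrences = begin
      ∑[ z ∈ values pws ] between (value (punchIn y ℓ)) (value y) z
        ≡⟨ ∑-map value (toList pws) _ ⟩
      ∑[ z ∈ toList pws ] between (value (punchIn y ℓ)) (value y) (value z)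
        ≡⟨ cong (λ zs → ∑[ z ∈ zs ] between (value (punchIn y ℓ)) (value y) (value z))
                (Vec.toList-map (punchIn y) ws) ⟩
      ∑[ z ∈ map (punchIn y) (toList ws) ] between (value (punchIn y ℓ)) (value y) (value z)
        ≡⟨ ∑-map (punchIn y) (toList ws) _ ⟩
      ∑[ z ∈ toList ws ] between (toℕ (punchIn y ℓ)) (toℕ y) (toℕ (punchIn y z))
        ≡⟨ ∑-cong (toList ws) (between-punchIn y ℓ) ⟩
      ∑ (toList ws) g
        ≡⟨ ℕ.+-identityʳ _ ⟨
      ∑ (toList ws) g + 0
        ≡⟨ cong (λ k → ∑ (toList ws) g + (k + 0)) (between-self (toℕ ℓ) (toℕ y)) ⟨
      ∑ (toList ws) g + ∑ [ ℓ ] g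
        ≡⟨ ∑-++ (toList ws) [ ℓ ] g ⟨
      ∑ (toList ws ++ [ ℓ ]) g
        ≡⟨ cong (λ zs → ∑ zs g) (Vec.toList-∷ʳ ℓ ws) ⟨
      ∑ (toList (ws ∷ʳ ℓ)) g
        ≡⟨ ∑-permutation (ws ∷ʳ ℓ) w! g ⟩
      ∑[ v < suc n ] g v
        ≡⟨ between-count (suc n) (toℕ ℓ) (toℕ y) (ℕ.≤-pred (Fin.toℕ<n y)) ⟩
      newOcc (toℕ y) (toℕ ℓ) ∎

  -- Permutations counted by their last value

  endingIn : ∀ {m k} → ℕ → ℕ → Vec (Fin m) (suc k) → ℕ
  endingIn x c w = χ (distinct? w) * χ (x ℕ.≟ toℕ (Vec.last w)) * χ (occ213 (values w) ℕ.≟ c)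

  -- Permutations of [n + 1] with last value x + 1 and exactly c occurrences of 2-13.
  ending : ℕ → ℕ → ℕ → ℕ
  ending n x c = ∑ (allWords (suc n) (suc n)) (endingIn x c)

  module _ (n x c : ℕ) where
    private
      N₁ N₂ : ℕ
      N₁ = suc n
      N₂ = suc (suc n)

      W₁ : List (Vec (Fin N₁) N₁)
      W₁ = allWords N₁ N₁

      W₂ : List (Vec (Fin N₂) N₁)
      W₂ = allWords N₂ N₁

      snocTerm : Vec (Fin N₂) N₁ → Fin N₂ → ℕ
      snocTerm w y = χ (distinct? w) * χ (x ℕ.≟ toℕ y) * χ (occ213 (values (w ∷ʳ y)) ℕ.≟ c)

      appended : ℕ → Vec (Fin N₁) N₁ → ℕ
      appended Y w = χ (distinct? w) * χ (occ213 (values w) + newOcc Y (toℕ (Vec.last w)) ℕ.≟ c)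

      recurrence : ℕ → ℕ
      recurrence Y =
        ∑[ ℓ < N₁ ] (χ (newOcc Y (toℕ ℓ) ℕ.≤? c) * ending n (toℕ ℓ) (c ∸ newOcc Y (toℕ ℓ)))

      split-snoc : ∀ w y → endingIn x c (w ∷ʳ y) ≡ χ (avoids? y w) * snocTerm w y
      split-snoc w y = begin
        χ (distinct? (w ∷ʳ y)) * χ (x ℕ.≟ toℕ (Vec.last (w ∷ʳ y))) * O
          ≡⟨ cong₂ (λ d l → d * χ (x ℕ.≟ toℕ l) * O) (χ-distinct-snoc w y) (Vec.last-∷ʳ y w) ⟩
        χ (distinct? w) * χ (avoids? y w) * χ (x ℕ.≟ toℕ y) * O
          ≡⟨ regroup (χ (distinct? w)) (χ (avoids? y w)) (χ (x ℕ.≟ toℕ y)) O ⟩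
        χ (avoids? y w) * snocTerm w y ∎
        where
        O = χ (occ213 (values (w ∷ʳ y)) ℕ.≟ c)
        regroup : ∀ d a l o → d * a * l * o ≡ a * (d * l * o)
        regroup = ℕ-Solver.solve-∀

      relabel : ∀ y w → snocTerm (Vec.map (punchIn y) w) y ≡ χ (x ℕ.≟ toℕ y) * appended (toℕ y) w
      relabel y w = trans (cong (λ d → d * X * O) (χ-distinct-punchIn y w)) (by-cases (distinct? w))
        where
        X = χ (x ℕ.≟ toℕ y)
        O = χ (occ213 (values (Vec.map (punchIn y) w ∷ʳ y)) ℕ.≟ c)
        O′ = χ (occ213 (values w) + newOcc (toℕ y) (toℕ (Vec.last w)) ℕ.≟ c)
        by-cases : (w!? : Dec (Distinct (toList w))) → χ w!? * X * O ≡ X * (χ w!? * O′)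
        by-cases (no  _)  = sym (ℕ.*-zeroʳ X)
        by-cases (yes w!) =
          trans (cong (λ o → 1 * X * χ (o ℕ.≟ c)) (occ-append w y w!)) (xy∙z≈y∙xz 1 X O′)

      by-last : ∀ Y → ∑ W₁ (appended Y) ≡ recurrence Y
      by-last Y = begin
        ∑ W₁ (appended Y)
          ≡⟨ ∑-cong W₁ insert-last ⟩
        ∑[ w ∈ W₁ ] ∑[ ℓ < N₁ ] (χ (new ℓ ℕ.≤? c) * term ℓ w)
          ≡⟨ ∑-swap W₁ N₁ (λ w ℓ → χ (new ℓ ℕ.≤? c) * term ℓ w) ⟩
        ∑[ ℓ < N₁ ] ∑[ w ∈ W₁ ] (χ (new ℓ ℕ.≤? c) * term ℓ w)
          ≡⟨ sum-cong-≗ {N₁} (λ ℓ → ∑-*ˡ W₁ (χ (new ℓ ℕ.≤? c)) (term ℓ)) ⟩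
        recurrence Y ∎
        where
        new : Fin N₁ → ℕ
        new ℓ = newOcc Y (toℕ ℓ)
        term : Fin N₁ → Vec (Fin N₁) N₁ → ℕ
        term ℓ = endingIn (toℕ ℓ) (c ∸ new ℓ)
        insert-last : ∀ w → appended Y w ≡ ∑[ ℓ < N₁ ] (χ (new ℓ ℕ.≤? c) * term ℓ w)
        insert-last w = begin
          D * χ (O + newOcc Y L ℕ.≟ c)
            ≡⟨ ∑-delta-toℕ N₁ L (Fin.toℕ<n (Vec.last w)) (λ l → D * χ (O + newOcc Y l ℕ.≟ c)) ⟨
          ∑[ ℓ < N₁ ] (χ (toℕ ℓ ℕ.≟ L) * (D * χ (O + new ℓ ℕ.≟ c)))
            ≡⟨ sum-cong-≗ {N₁} (λ ℓ → cong (λ k → χ (toℕ ℓ ℕ.≟ L) * (D * k))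
                                           (χ-+-≟ O (new ℓ) c)) ⟩
          ∑[ ℓ < N₁ ] (χ (toℕ ℓ ℕ.≟ L) * (D * (χ (new ℓ ℕ.≤? c) * χ (O ℕ.≟ c ∸ new ℓ))))
            ≡⟨ sum-cong-≗ {N₁} (λ ℓ → regroup (χ (toℕ ℓ ℕ.≟ L)) D (χ (new ℓ ℕ.≤? c))
                                             (χ (O ℕ.≟ c ∸ new ℓ))) ⟩
          ∑[ ℓ < N₁ ] (χ (new ℓ ℕ.≤? c) * term ℓ w) ∎
          where
          D = χ (distinct? w)
          O = occ213 (values w)
          L = toℕ (Vec.last w)
          regroup : ∀ e d k o → e * (d * (k * o)) ≡ k * (d * e * o)
          regroup = ℕ-Solver.solve-∀

    ending-suc : x < suc (suc n) →
      ending (suc n) x c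
      ≡ ∑[ ℓ < suc n ] (χ (newOcc x (toℕ ℓ) ℕ.≤? c) * ending n (toℕ ℓ) (c ∸ newOcc x (toℕ ℓ)))
    ending-suc x<N₂ = begin
      ending (suc n) x c
        ≡⟨ allWords-snoc N₂ N₁ (endingIn x c) ⟩
      ∑[ w ∈ W₂ ] ∑[ y < N₂ ] endingIn x c (w ∷ʳ y)
        ≡⟨ ∑-cong W₂ (λ w → sum-cong-≗ {N₂} (split-snoc w)) ⟩
      ∑[ w ∈ W₂ ] ∑[ y < N₂ ] (χ (avoids? y w) * snocTerm w y)
        ≡⟨ ∑-swap W₂ N₂ (λ w y → χ (avoids? y w) * snocTerm w y) ⟩
      ∑[ y < N₂ ] ∑[ w ∈ W₂ ] (χ (avoids? y w) * snocTerm w y)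
        ≡⟨ sum-cong-≗ {N₂} (λ y → allWords-avoiding N₁ N₁ y (λ w → snocTerm w y)) ⟩
      ∑[ y < N₂ ] ∑[ w ∈ W₁ ] snocTerm (Vec.map (punchIn y) w) y
        ≡⟨ sum-cong-≗ {N₂} (λ y → trans (∑-cong W₁ (relabel y))
                                         (∑-*ˡ W₁ (χ (x ℕ.≟ toℕ y)) (appended (toℕ y)))) ⟩
      ∑[ y < N₂ ] (χ (x ℕ.≟ toℕ y) * ∑ W₁ (appended (toℕ y)))
        ≡⟨ sum-cong-≗ {N₂} (λ y → cong (_* ∑ W₁ (appended (toℕ y))) (χ-≟-sym x (toℕ y))) ⟩
      ∑[ y < N₂ ] (χ (toℕ y ℕ.≟ x) * ∑ W₁ (appended (toℕ y)))
        ≡⟨ ∑-delta-toℕ N₂ x x<N₂ (λ Y → ∑ W₁ (appended Y)) ⟩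
      ∑ W₁ (appended x)
        ≡⟨ by-last x ⟩
      recurrence x ∎

  numPermsTwo213-by-last : ∀ n → numPermsTwo213 (suc n) ≡ ∑[ x < suc n ] ending n (toℕ x) 2
  numPermsTwo213-by-last n = begin
    numPermsTwo213 (suc n)
      ≡⟨ length-filter isCounted? W ⟩
    ∑[ w ∈ W ] χ (isCounted? w)
      ≡⟨ ∑-cong W split-last ⟩
    ∑[ w ∈ W ] ∑[ x < suc n ] endingIn (toℕ x) 2 w
      ≡⟨ ∑-swap W (suc n) (λ w x → endingIn (toℕ x) 2 w) ⟩
    ∑[ x < suc n ] ending n (toℕ x) 2 ∎
    where
    W = allWords (suc n) (suc n)
    split-last : ∀ w → χ (isCounted? w) ≡ ∑[ x < suc n ] endingIn (toℕ x) 2 w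
    split-last w = begin
      χ (isCounted? w)
        ≡⟨ 𝟙-∧ (does (distinct? w)) (does (occ213 (values w) ℕ.≟ 2)) ⟩
      D * O
        ≡⟨ ∑-delta-toℕ (suc n) L (Fin.toℕ<n (Vec.last w)) (λ _ → D * O) ⟨
      ∑[ x < suc n ] (χ (toℕ x ℕ.≟ L) * (D * O))
        ≡⟨ sum-cong-≗ {suc n} (λ x → x∙yz≈yx∙z (χ (toℕ x ℕ.≟ L)) D O) ⟩
      ∑[ x < suc n ] endingIn (toℕ x) 2 w ∎
      where
      D = χ (distinct? w)
      O = χ (occ213 (values w) ℕ.≟ 2)
      L = toℕ (Vec.last w)

module ClosedForms where

  open import Data.Integer using (ℤ; +_; _+_; _*_; _-_; -_; 0ℤ; 1ℤ)
  open import Data.Integer.Tactic.RingSolver using (solve-∀)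
  open import Algebra.Properties.CommutativeSemigroup ℤ.*-commutativeSemigroup
    using (x∙yz≈y∙xz; x∙yz≈yx∙z; x∙yz≈xz∙y; xy∙z≈xz∙y; xy∙z≈y∙xz)
  open import Data.Integer.Solver using (module +-*-Solver)
  open +-*-Solver using (Polynomial; op; con; var; _:^_; :-_; _:+_; _:*_; _:-_; ⟦_⟧; ⟦_⟧↓; prove)
  import Algebra.Solver.Ring as RingSolver
  open import Data.Vec using ([]; _∷_)
  open Counting using (𝟙; χ; newOcc; ending; ending-suc; numPermsTwo213-by-last)
  open ≡-Reasoning

  -- Binomial coefficients under shifts of their indices

  infixl 8 _↑_ _↓_

  _↑_ : ℤ → ℕ → ℤ
  x ↑ zero  = 1ℤ
  x ↑ suc n = x ↑ n * (x + + n)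

  _↓_ : ℤ → ℕ → ℤ
  x ↓ zero  = 1ℤ
  x ↓ suc n = x ↓ n * (x - + n)

  ↑-+ : ∀ x m n → x ↑ (m ℕ.+ n) ≡ x ↑ m * (x + + m) ↑ n
  ↑-+ x m zero    = begin
    x ↑ (m ℕ.+ 0) ≡⟨ cong (x ↑_) (ℕ.+-identityʳ m) ⟩
    x ↑ m         ≡⟨ ℤ.*-identityʳ (x ↑ m) ⟨
    x ↑ m * 1ℤ    ∎
  ↑-+ x m (suc n) = begin
    x ↑ (m ℕ.+ suc n)                     ≡⟨ cong (x ↑_) (ℕ.+-suc m n) ⟩
    x ↑ (m ℕ.+ n) * (x + + (m ℕ.+ n))
      ≡⟨ cong₂ _*_ (↑-+ x m n) (cong (λ y → x + y) (ℤ.pos-+ m n)) ⟩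
    x ↑ m * (x + + m) ↑ n * (x + (+ m + + n))
      ≡⟨ cong (x ↑ m * (x + + m) ↑ n *_) (ℤ.+-assoc x (+ m) (+ n)) ⟨
    x ↑ m * (x + + m) ↑ n * (x + + m + + n)
      ≡⟨ ℤ.*-assoc (x ↑ m) _ _ ⟩
    x ↑ m * ((x + + m) ↑ n * (x + + m + + n)) ∎

  absorption : ∀ m k → suc k ℕ.* (suc m C suc k) ≡ suc m ℕ.* (m C k)
  absorption zero    zero    = refl
  absorption zero    (suc k) = ℕ.*-zeroʳ (suc (suc k))
  absorption (suc m) zero    = trans (ℕ.+-identityʳ _) (trans (nC1≡n (suc (suc m))) (sym (ℕ.*-identityʳ _)))
  absorption (suc m) (suc k) = begin
    suc (suc k) ℕ.* (suc (suc m) C suc (suc k))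
      ≡⟨ cong (suc (suc k) ℕ.*_) (pascal (suc m) (suc k)) ⟨
    suc (suc k) ℕ.* (B₁ ℕ.+ B₂)
      ≡⟨ ℕ.*-distribˡ-+ (suc (suc k)) B₁ B₂ ⟩
    B₁ ℕ.+ suc k ℕ.* B₁ ℕ.+ suc (suc k) ℕ.* B₂
      ≡⟨ cong₂ (λ x y → B₁ ℕ.+ x ℕ.+ y) (absorption m k) (absorption m (suc k)) ⟩
    B₁ ℕ.+ suc m ℕ.* (m C k) ℕ.+ suc m ℕ.* (m C suc k)
      ≡⟨ rearrange B₁ (suc m) (m C k) (m C suc k) ⟩
    B₁ ℕ.+ suc m ℕ.* (m C k ℕ.+ m C suc k)
      ≡⟨ cong (λ x → B₁ ℕ.+ suc m ℕ.* x) (pascal m k) ⟩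
    suc (suc m) ℕ.* B₁ ∎
    where
    pascal = nCk+nC[k+1]≡[n+1]C[k+1]
    B₁ = suc m C suc k
    B₂ = suc m C suc (suc k)
    rearrange : ∀ b x y z → b ℕ.+ x ℕ.* y ℕ.+ x ℕ.* z ≡ b ℕ.+ x ℕ.* (y ℕ.+ z)
    rearrange = ℕ-Solver.solve-∀

  absorptionℤ : ∀ m k → + (suc m C suc k) * + suc k ≡ + (m C k) * + suc m
  absorptionℤ m k = begin
    + (suc m C suc k) * + suc k  ≡⟨ ℤ.pos-* (suc m C suc k) (suc k) ⟨
    + ((suc m C suc k) ℕ.* suc k) ≡⟨ cong +_ (ℕ.*-comm (suc m C suc k) (suc k)) ⟩
    + (suc k ℕ.* (suc m C suc k)) ≡⟨ cong +_ (absorption m k) ⟩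
    + (suc m ℕ.* (m C k))         ≡⟨ cong +_ (ℕ.*-comm (suc m) (m C k)) ⟩
    + ((m C k) ℕ.* suc m)         ≡⟨ ℤ.pos-* (m C k) (suc m) ⟩
    + (m C k) * + suc m           ∎

  lower-index-step : ∀ m k → + (m C suc k) * + suc k ≡ + (m C k) * (+ m - + k)
  lower-index-step m k = begin
    + (m C suc k) * + suc k
      ≡⟨ isolate (+ (m C k)) (+ (m C suc k)) (+ suc k) ⟩
    (+ (m C k) + + (m C suc k)) * + suc k - + (m C k) * + suc k
      ≡⟨ cong (λ x → x * + suc k - + (m C k) * + suc k) (ℤ.pos-+ (m C k) (m C suc k)) ⟨
    + (m C k ℕ.+ m C suc k) * + suc k - + (m C k) * + suc k
      ≡⟨ cong (λ x → + x * + suc k - + (m C k) * + suc k) (nCk+nC[k+1]≡[n+1]C[k+1] m k) ⟩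
    + (suc m C suc k) * + suc k - + (m C k) * + suc k
      ≡⟨ cong (_- + (m C k) * + suc k) (absorptionℤ m k) ⟩
    + (m C k) * + suc m - + (m C k) * + suc k
      ≡⟨ collect (+ (m C k)) (+ m) (+ k) ⟩
    + (m C k) * (+ m - + k) ∎
    where
    isolate : ∀ b b′ s → b′ * s ≡ (b + b′) * s - b * s
    isolate = solve-∀
    collect : ∀ b m k → b * (1ℤ + m) - b * (1ℤ + k) ≡ b * (m - k)
    collect = solve-∀

  diagonal-shift : ∀ u K i →
    + ((i ℕ.+ u) C (i ℕ.+ K)) * (+ suc K) ↑ i ≡ + (u C K) * (+ suc u) ↑ i
  diagonal-shift u K zero    = refl
  diagonal-shift u K (suc i) = begin
    + B′ * ((+ suc K) ↑ i * (+ suc K + + i))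
      ≡⟨ cong (λ x → + B′ * ((+ suc K) ↑ i * + suc x)) (ℕ.+-comm K i) ⟩
    + B′ * ((+ suc K) ↑ i * + suc (i ℕ.+ K))
      ≡⟨ x∙yz≈y∙xz (+ B′) ((+ suc K) ↑ i) (+ suc (i ℕ.+ K)) ⟩
    (+ suc K) ↑ i * (+ B′ * + suc (i ℕ.+ K))
      ≡⟨ cong ((+ suc K) ↑ i *_) (absorptionℤ (i ℕ.+ u) (i ℕ.+ K)) ⟩
    (+ suc K) ↑ i * (+ B * + suc (i ℕ.+ u))
      ≡⟨ x∙yz≈yx∙z ((+ suc K) ↑ i) (+ B) (+ suc (i ℕ.+ u)) ⟩
    + B * (+ suc K) ↑ i * + suc (i ℕ.+ u)
      ≡⟨ cong (_* + suc (i ℕ.+ u)) (diagonal-shift u K i) ⟩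
    + (u C K) * (+ suc u) ↑ i * + suc (i ℕ.+ u)
      ≡⟨ cong (λ x → + (u C K) * (+ suc u) ↑ i * + suc x) (ℕ.+-comm i u) ⟩
    + (u C K) * (+ suc u) ↑ i * (+ suc u + + i)
      ≡⟨ ℤ.*-assoc (+ (u C K)) _ _ ⟩
    + (u C K) * ((+ suc u) ↑ i * (+ suc u + + i)) ∎
    where
    B  = (i ℕ.+ u) C (i ℕ.+ K)
    B′ = suc (i ℕ.+ u) C suc (i ℕ.+ K)

  upward-shift : ∀ m k d →
    + (m C (d ℕ.+ k)) * (+ suc k) ↑ d ≡ + (m C k) * (+ m - + k) ↓ d
  upward-shift m k zero    = refl
  upward-shift m k (suc d) = begin
    + (m C suc (d ℕ.+ k)) * ((+ suc k) ↑ d * (+ suc k + + d))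
      ≡⟨ cong (λ x → + (m C suc (d ℕ.+ k)) * ((+ suc k) ↑ d * + suc x)) (ℕ.+-comm k d) ⟩
    + (m C suc (d ℕ.+ k)) * ((+ suc k) ↑ d * + suc (d ℕ.+ k))
      ≡⟨ x∙yz≈y∙xz (+ (m C suc (d ℕ.+ k))) ((+ suc k) ↑ d) (+ suc (d ℕ.+ k)) ⟩
    (+ suc k) ↑ d * (+ (m C suc (d ℕ.+ k)) * + suc (d ℕ.+ k))
      ≡⟨ cong ((+ suc k) ↑ d *_) (lower-index-step m (d ℕ.+ k)) ⟩
    (+ suc k) ↑ d * (+ (m C (d ℕ.+ k)) * (+ m - + (d ℕ.+ k)))
      ≡⟨ x∙yz≈yx∙z ((+ suc k) ↑ d) (+ (m C (d ℕ.+ k))) (+ m - + (d ℕ.+ k)) ⟩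
    + (m C (d ℕ.+ k)) * (+ suc k) ↑ d * (+ m - + (d ℕ.+ k))
      ≡⟨ cong₂ _*_ (upward-shift m k d) (cong (λ x → + m - x) (ℤ.pos-+ d k)) ⟩
    + (m C k) * (+ m - + k) ↓ d * (+ m - (+ d + + k))
      ≡⟨ regroup (+ (m C k)) ((+ m - + k) ↓ d) (+ m) (+ k) (+ d) ⟩
    + (m C k) * ((+ m - + k) ↓ d * (+ m - + k - + d)) ∎
    where
    regroup : ∀ b f m k d → b * f * (m - (d + k)) ≡ b * (f * (m - k - d))
    regroup = solve-∀

  binomial-shift : ∀ u K i d →
    + ((i ℕ.+ u) C (d ℕ.+ (i ℕ.+ K))) * (+ suc K) ↑ (i ℕ.+ d)
    ≡ + (u C K) * ((+ suc u) ↑ i * (+ u - + K) ↓ d)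
  binomial-shift u K i d = begin
    + B * (+ suc K) ↑ (i ℕ.+ d)
      ≡⟨ cong (+ B *_) (↑-+ (+ suc K) i d) ⟩
    + B * ((+ suc K) ↑ i * (+ suc K + + i) ↑ d)
      ≡⟨ cong (λ x → + B * ((+ suc K) ↑ i * (+ suc x) ↑ d)) (ℕ.+-comm K i) ⟩
    + B * ((+ suc K) ↑ i * (+ suc (i ℕ.+ K)) ↑ d)
      ≡⟨ x∙yz≈xz∙y (+ B) ((+ suc K) ↑ i) ((+ suc (i ℕ.+ K)) ↑ d) ⟩
    + B * (+ suc (i ℕ.+ K)) ↑ d * (+ suc K) ↑ i
      ≡⟨ cong (_* (+ suc K) ↑ i) (upward-shift (i ℕ.+ u) (i ℕ.+ K) d) ⟩
    + ((i ℕ.+ u) C (i ℕ.+ K)) * (+ (i ℕ.+ u) - + (i ℕ.+ K)) ↓ d * (+ suc K) ↑ i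
      ≡⟨ cong (λ x → + ((i ℕ.+ u) C (i ℕ.+ K)) * x ↓ d * (+ suc K) ↑ i) (cancel-shift i u K) ⟩
    + ((i ℕ.+ u) C (i ℕ.+ K)) * (+ u - + K) ↓ d * (+ suc K) ↑ i
      ≡⟨ xy∙z≈xz∙y (+ ((i ℕ.+ u) C (i ℕ.+ K))) ((+ u - + K) ↓ d) ((+ suc K) ↑ i) ⟩
    + ((i ℕ.+ u) C (i ℕ.+ K)) * (+ suc K) ↑ i * (+ u - + K) ↓ d
      ≡⟨ cong (_* (+ u - + K) ↓ d) (diagonal-shift u K i) ⟩
    + (u C K) * (+ suc u) ↑ i * (+ u - + K) ↓ d
      ≡⟨ ℤ.*-assoc (+ (u C K)) _ _ ⟩
    + (u C K) * ((+ suc u) ↑ i * (+ u - + K) ↓ d) ∎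
    where
    B = (i ℕ.+ u) C (d ℕ.+ (i ℕ.+ K))
    cancel-shift : ∀ i u K → + (i ℕ.+ u) - + (i ℕ.+ K) ≡ + u - + K
    cancel-shift i u K = begin
      + (i ℕ.+ u) - + (i ℕ.+ K)   ≡⟨ cong₂ _-_ (ℤ.pos-+ i u) (ℤ.pos-+ i K) ⟩
      + i + + u - (+ i + + K)     ≡⟨ cancel (+ i) (+ u) (+ K) ⟩
      + u - + K                   ∎
      where
      cancel : ∀ i u K → i + u - (i + K) ≡ u - K
      cancel = solve-∀

  -- Certificates for identities between binomial coefficients

  infixl 9 _:↑_ _:↓_

  _:↑_ : ∀ {n} → Polynomial n → ℕ → Polynomial n
  p :↑ zero  = con 1ℤ
  p :↑ suc m = p :↑ m :* (p :+ con (+ m))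

  _:↓_ : ∀ {n} → Polynomial n → ℕ → Polynomial n
  p :↓ zero  = con 1ℤ
  p :↓ suc m = p :↓ m :* (p :- con (+ m))

  ⟦:↑⟧ : ∀ {n} (p : Polynomial n) m ρ → ⟦ p :↑ m ⟧ ρ ≡ ⟦ p ⟧ ρ ↑ m
  ⟦:↑⟧ p zero    ρ = refl
  ⟦:↑⟧ p (suc m) ρ = cong (_* (⟦ p ⟧ ρ + + m)) (⟦:↑⟧ p m ρ)

  ⟦:↓⟧ : ∀ {n} (p : Polynomial n) m ρ → ⟦ p :↓ m ⟧ ρ ≡ ⟦ p ⟧ ρ ↓ m
  ⟦:↓⟧ p zero    ρ = refl
  ⟦:↓⟧ p (suc m) ρ = cong (_* (⟦ p ⟧ ρ - + m)) (⟦:↓⟧ p m ρ)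

  substitute : ∀ {n} → Polynomial 2 → Polynomial n → Polynomial n → Polynomial n
  substitute (op o p q)     σ₀ σ₁ = op o (substitute p σ₀ σ₁) (substitute q σ₀ σ₁)
  substitute (con c)        σ₀ σ₁ = con c
  substitute (var zero)     σ₀ σ₁ = σ₀
  substitute (var (suc _))  σ₀ σ₁ = σ₁
  substitute (p :^ k)       σ₀ σ₁ = substitute p σ₀ σ₁ :^ k
  substitute (:- p)         σ₀ σ₁ = :- substitute p σ₀ σ₁

  ⟦substitute⟧ : ∀ {n} p (σ₀ σ₁ : Polynomial n) ρ →
    ⟦ substitute p σ₀ σ₁ ⟧ ρ ≡ ⟦ p ⟧ (⟦ σ₀ ⟧ ρ ∷ ⟦ σ₁ ⟧ ρ ∷ [])
  ⟦substitute⟧ (op RingSolver.[+] p q) σ₀ σ₁ ρ =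
    cong₂ _+_ (⟦substitute⟧ p σ₀ σ₁ ρ) (⟦substitute⟧ q σ₀ σ₁ ρ)
  ⟦substitute⟧ (op RingSolver.[*] p q) σ₀ σ₁ ρ =
    cong₂ _*_ (⟦substitute⟧ p σ₀ σ₁ ρ) (⟦substitute⟧ q σ₀ σ₁ ρ)
  ⟦substitute⟧ (con c)       σ₀ σ₁ ρ = refl
  ⟦substitute⟧ (var zero)    σ₀ σ₁ ρ = refl
  ⟦substitute⟧ (var (suc zero)) σ₀ σ₁ ρ = refl
  ⟦substitute⟧ (p :^ k)      σ₀ σ₁ ρ rewrite ⟦substitute⟧ p σ₀ σ₁ ρ = refl
  ⟦substitute⟧ (:- p)        σ₀ σ₁ ρ = cong -_ (⟦substitute⟧ p σ₀ σ₁ ρ)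

  rising-nonZero : ∀ k m → ℤ.NonZero ((+ suc k) ↑ m)
  rising-nonZero k zero    = _
  rising-nonZero k (suc m) = ℤ.i*j≢0 ((+ suc k) ↑ m) (+ suc k + + m) {{rising-nonZero k m}}

  record BinomialTerm (n : ℕ) : Set where
    constructor term
    field
      coefficient : Polynomial n
      top-shift   : ℕ
      gap         : ℕ

    size : ℕ
    size = top-shift ℕ.+ gap

  open BinomialTerm

  degree : ∀ {n} → List (BinomialTerm n) → ℕ
  degree []       = 0
  degree (t ∷ ts) = size t ⊔ degree ts

  -- By binomial-shift, (K + 1)↑(i + d) · C(i + u, K + i + d) is C(u, K) times a polynomial in u and K.
  -- Scaling a list of such terms by (K + 1)↑M, with M their largest i + d, thus reduces the vanishing
  -- of their sum to the vanishing of a polynomial, which the ring solver decides.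
  module Normalisation {n} (ρ : Vec ℤ n) {u K : ℕ} (uS KS : Polynomial n)
                       (⟦uS⟧ : ⟦ uS ⟧ ρ ≡ + u) (⟦KS⟧ : ⟦ KS ⟧ ρ ≡ + K) where

    termValue : BinomialTerm n → ℤ
    termValue (term q i d) = ⟦ q ⟧ ρ * + ((i ℕ.+ u) C (d ℕ.+ (i ℕ.+ K)))

    termsValue : List (BinomialTerm n) → ℤ
    termsValue []       = 0ℤ
    termsValue (t ∷ ts) = termValue t + termsValue ts

    normalTerm : ℕ → BinomialTerm n → Polynomial n
    normalTerm M (term q i d) =
      q :* ((con 1ℤ :+ uS) :↑ i
        :* ((uS :- KS) :↓ d :* (con (+ suc (i ℕ.+ d)) :+ KS) :↑ (M ℕ.∸ (i ℕ.+ d))))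

    normalForm : ℕ → List (BinomialTerm n) → Polynomial n
    normalForm M []       = con 0ℤ
    normalForm M (t ∷ ts) = normalTerm M t :+ normalForm M ts

    ⟦normalTerm⟧ : ∀ M q i d → ⟦ normalTerm M (term q i d) ⟧ ρ
      ≡ ⟦ q ⟧ ρ * ((+ suc u) ↑ i * ((+ u - + K) ↓ d * (+ suc K + + (i ℕ.+ d)) ↑ (M ℕ.∸ (i ℕ.+ d))))
    ⟦normalTerm⟧ M q i d =
      cong (⟦ q ⟧ ρ *_) (cong₂ _*_ rising (cong₂ _*_ falling rest))
      where
      rising : ⟦ (con 1ℤ :+ uS) :↑ i ⟧ ρ ≡ (+ suc u) ↑ i
      rising = trans (⟦:↑⟧ _ i ρ) (cong (λ x → (1ℤ + x) ↑ i) ⟦uS⟧)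
      falling : ⟦ (uS :- KS) :↓ d ⟧ ρ ≡ (+ u - + K) ↓ d
      falling = trans (⟦:↓⟧ _ d ρ) (cong₂ (λ x y → (x - y) ↓ d) ⟦uS⟧ ⟦KS⟧)
      rest : ⟦ (con (+ suc (i ℕ.+ d)) :+ KS) :↑ (M ℕ.∸ (i ℕ.+ d)) ⟧ ρ
           ≡ (+ suc K + + (i ℕ.+ d)) ↑ (M ℕ.∸ (i ℕ.+ d))
      rest = trans (⟦:↑⟧ (con (+ suc (i ℕ.+ d)) :+ KS) (M ℕ.∸ (i ℕ.+ d)) ρ)
        (cong (_↑ (M ℕ.∸ (i ℕ.+ d)))
        (trans (cong (λ y → + suc (i ℕ.+ d) + y) ⟦KS⟧) (cong (λ x → + suc x) (ℕ.+-comm (i ℕ.+ d) K))))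

    normalTerm-sound : ∀ M t → size t ≤ M →
      (+ suc K) ↑ M * termValue t ≡ + (u C K) * ⟦ normalTerm M t ⟧ ρ
    normalTerm-sound M (term q i d) size≤M = begin
      (+ suc K) ↑ M * (Q * + B)
        ≡⟨ cong (λ m → (+ suc K) ↑ m * (Q * + B)) (ℕ.m+[n∸m]≡n size≤M) ⟨
      (+ suc K) ↑ (i ℕ.+ d ℕ.+ r) * (Q * + B)
        ≡⟨ cong (_* (Q * + B)) (↑-+ (+ suc K) (i ℕ.+ d) r) ⟩
      (+ suc K) ↑ (i ℕ.+ d) * R * (Q * + B)
        ≡⟨ regroup ((+ suc K) ↑ (i ℕ.+ d)) R Q (+ B) ⟩
      Q * (+ B * (+ suc K) ↑ (i ℕ.+ d)) * R
        ≡⟨ cong (λ x → Q * x * R) (binomial-shift u K i d) ⟩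
      Q * (+ (u C K) * ((+ suc u) ↑ i * (+ u - + K) ↓ d)) * R
        ≡⟨ regroup′ Q (+ (u C K)) ((+ suc u) ↑ i) ((+ u - + K) ↓ d) R ⟩
      + (u C K) * (Q * ((+ suc u) ↑ i * ((+ u - + K) ↓ d * R)))
        ≡⟨ cong (+ (u C K) *_) (⟦normalTerm⟧ M q i d) ⟨
      + (u C K) * ⟦ normalTerm M (term q i d) ⟧ ρ ∎
      where
      Q = ⟦ q ⟧ ρ
      B = (i ℕ.+ u) C (d ℕ.+ (i ℕ.+ K))
      r = M ℕ.∸ (i ℕ.+ d)
      R = (+ suc K + + (i ℕ.+ d)) ↑ r
      regroup : ∀ a r q b → a * r * (q * b) ≡ q * (b * a) * r
      regroup = solve-∀
      regroup′ : ∀ q c x y r → q * (c * (x * y)) * r ≡ c * (q * (x * (y * r)))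
      regroup′ = solve-∀

    normalForm-sound : ∀ M ts → degree ts ≤ M →
      (+ suc K) ↑ M * termsValue ts ≡ + (u C K) * ⟦ normalForm M ts ⟧ ρ
    normalForm-sound M []       _ = trans (ℤ.*-zeroʳ ((+ suc K) ↑ M)) (sym (ℤ.*-zeroʳ (+ (u C K))))
    normalForm-sound M (t ∷ ts) degree≤M = begin
      (+ suc K) ↑ M * (termValue t + termsValue ts)
        ≡⟨ ℤ.*-distribˡ-+ ((+ suc K) ↑ M) (termValue t) (termsValue ts) ⟩
      (+ suc K) ↑ M * termValue t + (+ suc K) ↑ M * termsValue ts
        ≡⟨ cong₂ _+_ (normalTerm-sound M t (ℕ.m⊔n≤o⇒m≤o (size t) (degree ts) degree≤M))
                     (normalForm-sound M ts (ℕ.m⊔n≤o⇒n≤o (size t) (degree ts) degree≤M)) ⟩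
      + (u C K) * ⟦ normalTerm M t ⟧ ρ + + (u C K) * ⟦ normalForm M ts ⟧ ρ
        ≡⟨ ℤ.*-distribˡ-+ (+ (u C K)) _ _ ⟨
      + (u C K) * ⟦ normalForm M (t ∷ ts) ⟧ ρ ∎

    vanishing : ∀ ts → ⟦ normalForm (degree ts) ts ⟧ ρ ≡ 0ℤ → termsValue ts ≡ 0ℤ
    vanishing ts normal≡0 = ℤ.*-cancelˡ-≡ ((+ suc K) ↑ degree ts) (termsValue ts) 0ℤ
      {{rising-nonZero K (degree ts)}}
      (begin
        (+ suc K) ↑ degree ts * termsValue ts    ≡⟨ normalForm-sound (degree ts) ts ℕ.≤-refl ⟩
        + (u C K) * ⟦ normalForm (degree ts) ts ⟧ ρ ≡⟨ cong (+ (u C K) *_) normal≡0 ⟩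
        + (u C K) * 0ℤ                         ≡⟨ ℤ.*-zeroʳ (+ (u C K)) ⟩
        0ℤ                                     ≡⟨ ℤ.*-zeroʳ ((+ suc K) ↑ degree ts) ⟨
        (+ suc K) ↑ degree ts * 0ℤ             ∎)

  ClosedTerm : Set
  ClosedTerm = ℕ × Polynomial 2

  private
    ℓ̂ N̂ : Polynomial 2
    ℓ̂ = var zero
    N̂ = var (suc zero)

  -- It is
  -- twice the number of permutations of [N] with c occurrences of 2-13 and last value > ℓ (doubling
  -- keeps the coefficients integral); N ∸ 4 makes the formula meaningful only for N ≥ 4.
  closedTerms : ℕ → List ClosedTerm
  closedTerms 0 = (4 , con (+ 2)) ∷ (5 , con (- + 2)) ∷ []
  closedTerms 1 = (2 , con (- + 2)) ∷ (3 , con (+ 2) :* ℓ̂ :- con (+ 2))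
                ∷ (4 , con (+ 2)) ∷ (5 , con (+ 2)) ∷ (6 , con (+ 2)) ∷ (7 , con (+ 2)) ∷ []
  closedTerms 2 = (0 , con (+ 6) :+ ℓ̂ :- ℓ̂ :* ℓ̂ :+ con (+ 2) :* N̂ :+ N̂ :* ℓ̂)
                ∷ (1 , con (+ 14) :+ ℓ̂ :- ℓ̂ :* ℓ̂)
                ∷ (2 , con (+ 12) :- con (+ 4) :* ℓ̂)
                ∷ (3 , con (+ 4) :- con (+ 4) :* ℓ̂)
                ∷ (4 , con (- + 4) :- con (+ 4) :* ℓ̂)
                ∷ (5 , con (- + 12) :- con (+ 2) :* ℓ̂)
                ∷ (6 , con (- + 14)) ∷ (7 , con (- + 10)) ∷ (8 , con (- + 4)) ∷ []
  closedTerms _ = []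

  closedTerm : ClosedTerm → ℕ → ℕ → ℤ
  closedTerm (j , q) N ℓ = ⟦ q ⟧ (+ ℓ ∷ + N ∷ []) * + (((N ℕ.+ N) ∸ suc ℓ) C (j ℕ.+ (N ∸ 4)))

  closedSum : List ClosedTerm → ℕ → ℕ → ℤ
  closedSum []       N ℓ = 0ℤ
  closedSum (t ∷ ts) N ℓ = closedTerm t N ℓ + closedSum ts N ℓ

  closed : ℕ → ℕ → ℕ → ℤ
  closed c = closedSum (closedTerms c)

  point : ℕ → ℕ → ℕ → ℤ
  point c N x = closed c N x - closed c N (suc x)

  record Occurrence (n : ℕ) : Set where
    constructor occurrence
    field
      weight  : Polynomial n
      form    : ℕ
      N-shift : ℕ
      ℓ-shift : ℕ

  open Occurrence

  top-index : ∀ a b β ℓ₀ N₀ → suc b ≤ a ℕ.+ a ℕ.+ β → β ℕ.+ ℓ₀ ≤ N₀ ℕ.+ N₀ →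
    (a ℕ.+ N₀) ℕ.+ (a ℕ.+ N₀) ∸ suc (b ℕ.+ ℓ₀)
    ≡ (a ℕ.+ a ℕ.+ β ∸ suc b) ℕ.+ (N₀ ℕ.+ N₀ ∸ (β ℕ.+ ℓ₀))
  top-index a b β ℓ₀ N₀ b<2a+β room = begin
    (a ℕ.+ N₀) ℕ.+ (a ℕ.+ N₀) ∸ suc (b ℕ.+ ℓ₀)
      ≡⟨ cong (_∸ suc (b ℕ.+ ℓ₀)) total ⟩
    suc (b ℕ.+ ℓ₀) ℕ.+ (i ℕ.+ u) ∸ suc (b ℕ.+ ℓ₀)
      ≡⟨ ℕ.m+n∸m≡n (suc (b ℕ.+ ℓ₀)) (i ℕ.+ u) ⟩
    i ℕ.+ u ∎
    where
    i = a ℕ.+ a ℕ.+ β ∸ suc b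
    u = N₀ ℕ.+ N₀ ∸ (β ℕ.+ ℓ₀)
    total : (a ℕ.+ N₀) ℕ.+ (a ℕ.+ N₀) ≡ suc (b ℕ.+ ℓ₀) ℕ.+ (i ℕ.+ u)
    total = ℕ.+-cancelʳ-≡ β _ _ (begin
      (a ℕ.+ N₀) ℕ.+ (a ℕ.+ N₀) ℕ.+ β
        ≡⟨ regroup a N₀ β ⟩
      (a ℕ.+ a ℕ.+ β) ℕ.+ (N₀ ℕ.+ N₀)
        ≡⟨ cong₂ ℕ._+_ (ℕ.m+[n∸m]≡n b<2a+β) (ℕ.m+[n∸m]≡n room) ⟨
      (suc b ℕ.+ i) ℕ.+ ((β ℕ.+ ℓ₀) ℕ.+ u)
        ≡⟨ regroup′ b i ℓ₀ β u ⟩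
      suc (b ℕ.+ ℓ₀) ℕ.+ (i ℕ.+ u) ℕ.+ β ∎)
      where
      regroup : ∀ a N β → (a ℕ.+ N) ℕ.+ (a ℕ.+ N) ℕ.+ β ≡ (a ℕ.+ a ℕ.+ β) ℕ.+ (N ℕ.+ N)
      regroup = ℕ-Solver.solve-∀
      regroup′ : ∀ b i ℓ β u →
        (suc b ℕ.+ i) ℕ.+ ((β ℕ.+ ℓ) ℕ.+ u) ≡ suc (b ℕ.+ ℓ) ℕ.+ (i ℕ.+ u) ℕ.+ β
      regroup′ = ℕ-Solver.solve-∀

  lower-index : ∀ j a i K → i ≤ j ℕ.+ suc a →
    j ℕ.+ ((a ℕ.+ (5 ℕ.+ K)) ∸ 4) ≡ (j ℕ.+ suc a ∸ i) ℕ.+ (i ℕ.+ K)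
  lower-index j a i K i≤ = begin
    j ℕ.+ ((a ℕ.+ (5 ℕ.+ K)) ∸ 4)    ≡⟨ cong (λ m → j ℕ.+ (m ∸ 4)) (shuffle a K) ⟩
    j ℕ.+ (suc a ℕ.+ K)              ≡⟨ ℕ.+-assoc j (suc a) K ⟨
    j ℕ.+ suc a ℕ.+ K                ≡⟨ cong (ℕ._+ K) (ℕ.m∸n+n≡m i≤) ⟨
    (j ℕ.+ suc a ∸ i) ℕ.+ i ℕ.+ K    ≡⟨ ℕ.+-assoc (j ℕ.+ suc a ∸ i) i K ⟩
    (j ℕ.+ suc a ∸ i) ℕ.+ (i ℕ.+ K)  ∎
    where
    shuffle : ∀ a K → a ℕ.+ (5 ℕ.+ K) ≡ 4 ℕ.+ (suc a ℕ.+ K)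
    shuffle = ℕ-Solver.solve-∀

  -- An occurrence (w, c, a, b) stands for w · closed c (a + N₀) (b + ℓ₀), where N₀ = 5 + K.  The
  -- binomial of its pair (j, q) is C(u + i, K + i + d) with u = 2N₀ - β - ℓ₀, i = 2a + β - b - 1 and
  -- i + d = j + a + 1; the offset β is chosen for each identity so that i, d ≥ 0 (admissible).
  module Frame {n} (ρ : Vec ℤ n) (σℓ σK : Polynomial n) {ℓ₀ K : ℕ}
               (⟦σℓ⟧ : ⟦ σℓ ⟧ ρ ≡ + ℓ₀) (⟦σK⟧ : ⟦ σK ⟧ ρ ≡ + K)
               (β : ℕ) (room : β ℕ.+ ℓ₀ ≤ (5 ℕ.+ K) ℕ.+ (5 ℕ.+ K)) where

    N₀ : ℕ
    N₀ = 5 ℕ.+ K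

    σN : Polynomial n
    σN = con (+ 5) :+ σK

    uS : Polynomial n
    uS = σN :+ σN :- σℓ :- con (+ β)

    ⟦uS⟧ : ⟦ uS ⟧ ρ ≡ + (N₀ ℕ.+ N₀ ∸ (β ℕ.+ ℓ₀))
    ⟦uS⟧ = begin
      ⟦ σN ⟧ ρ + ⟦ σN ⟧ ρ - ⟦ σℓ ⟧ ρ - + β
        ≡⟨ cong₂ (λ x y → x + x - y - + β) (cong (λ k → + 5 + k) ⟦σK⟧) ⟦σℓ⟧ ⟩
      + N₀ + + N₀ - + ℓ₀ - + β              ≡⟨ collect (+ N₀) (+ ℓ₀) (+ β) ⟩
      (+ N₀ + + N₀) - (+ β + + ℓ₀)          ≡⟨ cong₂ _-_ (ℤ.pos-+ N₀ N₀) (ℤ.pos-+ β ℓ₀) ⟨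
      + (N₀ ℕ.+ N₀) - + (β ℕ.+ ℓ₀)          ≡⟨ ℤ.m-n≡m⊖n (N₀ ℕ.+ N₀) (β ℕ.+ ℓ₀) ⟩
      (N₀ ℕ.+ N₀) ℤ.⊖ (β ℕ.+ ℓ₀)            ≡⟨ ℤ.⊖-≥ room ⟩
      + (N₀ ℕ.+ N₀ ∸ (β ℕ.+ ℓ₀))            ∎
      where
      collect : ∀ N ℓ b → N + N - ℓ - b ≡ (N + N) - (b + ℓ)
      collect = solve-∀

    open Normalisation ρ uS σK ⟦uS⟧ ⟦σK⟧ public

    topShift : Occurrence n → ℕ
    topShift o = N-shift o ℕ.+ N-shift o ℕ.+ β ∸ suc (ℓ-shift o)

    fits : Occurrence n → List ClosedTerm → Bool
    fits o []            = Bool.true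
    fits o ((j , _) ∷ L) = (topShift o ≤ᵇ j ℕ.+ suc (N-shift o)) ∧ fits o L

    admissible : Occurrence n → Bool
    admissible o = (suc (ℓ-shift o) ≤ᵇ N-shift o ℕ.+ N-shift o ℕ.+ β) ∧ fits o (closedTerms (form o))

    toTerm : Occurrence n → ClosedTerm → BinomialTerm n
    toTerm o (j , q) = term
      (weight o :* substitute q (con (+ ℓ-shift o) :+ σℓ) (con (+ N-shift o) :+ σN))
      (topShift o) (j ℕ.+ suc (N-shift o) ∸ topShift o)

    occurrenceTerms : Occurrence n → List (BinomialTerm n)
    occurrenceTerms o = map (toTerm o) (closedTerms (form o))

    valueAt : Occurrence n → ℤ
    valueAt o = ⟦ weight o ⟧ ρ * closed (form o) (N-shift o ℕ.+ N₀) (ℓ-shift o ℕ.+ ℓ₀)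

    module _ (o : Occurrence n) (top-ok : suc (ℓ-shift o) ≤ N-shift o ℕ.+ N-shift o ℕ.+ β) where
      private
        a = N-shift o
        b = ℓ-shift o
        i = topShift o
        W = ⟦ weight o ⟧ ρ

      toTerm-sound : ∀ j q → i ≤ j ℕ.+ suc a →
        W * closedTerm (j , q) (a ℕ.+ N₀) (b ℕ.+ ℓ₀) ≡ termValue (toTerm o (j , q))
      toTerm-sound j q i≤ = begin
        W * (Q * + (top C lower))
          ≡⟨ ℤ.*-assoc W Q _ ⟨
        W * Q * + (top C lower)
          ≡⟨ cong₂ (λ x y → W * x * + y) substituted
                   (cong₂ _C_ (top-index a b β ℓ₀ N₀ top-ok room) (lower-index j a i K i≤)) ⟩
        termValue (toTerm o (j , q)) ∎
        where
        Q = ⟦ q ⟧ (+ (b ℕ.+ ℓ₀) ∷ + (a ℕ.+ N₀) ∷ [])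
        top = (a ℕ.+ N₀) ℕ.+ (a ℕ.+ N₀) ∸ suc (b ℕ.+ ℓ₀)
        lower = j ℕ.+ ((a ℕ.+ N₀) ∸ 4)
        substituted : Q ≡ ⟦ substitute q (con (+ b) :+ σℓ) (con (+ a) :+ σN) ⟧ ρ
        substituted = sym (trans (⟦substitute⟧ q _ _ ρ)
          (cong₂ (λ x y → ⟦ q ⟧ (+ b + x ∷ + a + (+ 5 + y) ∷ [])) ⟦σℓ⟧ ⟦σK⟧))

      fits-sound : ∀ L → T (fits o L) →
        W * closedSum L (a ℕ.+ N₀) (b ℕ.+ ℓ₀) ≡ termsValue (map (toTerm o) L)
      fits-sound []            _  = ℤ.*-zeroʳ W
      fits-sound ((j , q) ∷ L) ok = trans (ℤ.*-distribˡ-+ W _ _)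
        (cong₂ _+_ (toTerm-sound j q (ℕ.≤ᵇ⇒≤ _ _ (proj₁ ok′))) (fits-sound L (proj₂ ok′)))
        where ok′ = Equivalence.to T-∧ ok

    occurrence-sound : ∀ o → T (admissible o) → valueAt o ≡ termsValue (occurrenceTerms o)
    occurrence-sound o ok =
      fits-sound o (ℕ.≤ᵇ⇒≤ _ _ (proj₁ ok′)) (closedTerms (form o)) (proj₂ ok′)
      where ok′ = Equivalence.to T-∧ ok

    combination : List (Occurrence n) → ℤ
    combination []       = 0ℤ
    combination (o ∷ os) = valueAt o + combination os

    allAdmissible : List (Occurrence n) → Bool
    allAdmissible []       = Bool.true
    allAdmissible (o ∷ os) = admissible o ∧ allAdmissible os

    terms : List (Occurrence n) → List (BinomialTerm n) → List (BinomialTerm n)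
    terms os extra = concatMap occurrenceTerms os ++ extra

    termsValue-++ : ∀ ts ts′ → termsValue (ts ++ ts′) ≡ termsValue ts + termsValue ts′
    termsValue-++ []       ts′ = sym (ℤ.+-identityˡ _)
    termsValue-++ (t ∷ ts) ts′ = trans (cong (λ s → termValue t + s) (termsValue-++ ts ts′)) (sym (ℤ.+-assoc (termValue t) _ _))

    combination-sound : ∀ os extra → T (allAdmissible os) →
      combination os + termsValue extra ≡ termsValue (terms os extra)
    combination-sound []       extra _  = ℤ.+-identityˡ _
    combination-sound (o ∷ os) extra ok = begin
      valueAt o + combination os + termsValue extra
        ≡⟨ ℤ.+-assoc (valueAt o) _ _ ⟩
      valueAt o + (combination os + termsValue extra)
        ≡⟨ cong₂ _+_ (occurrence-sound o (proj₁ ok′)) (combination-sound os extra (proj₂ ok′)) ⟩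
      termsValue (occurrenceTerms o) + termsValue (terms os extra)
        ≡⟨ termsValue-++ (occurrenceTerms o) (terms os extra) ⟨
      termsValue (occurrenceTerms o ++ terms os extra)
        ≡⟨ cong termsValue (List.++-assoc (occurrenceTerms o) _ extra) ⟨
      termsValue (terms (o ∷ os) extra) ∎
      where
      ok′ = Equivalence.to T-∧ ok

    Certified : List (Occurrence n) → List (BinomialTerm n) → Set
    Certified os extra = T (allAdmissible os)
      × ⟦ normalForm (degree (terms os extra)) (terms os extra) ⟧↓ ρ ≡ ⟦ con 0ℤ ⟧↓ ρ

    identity : ∀ os extra → Certified os extra → combination os + termsValue extra ≡ 0ℤ
    identity os extra (ok , certificate) = trans (combination-sound os extra ok)
      (vanishing (terms os extra) (prove ρ (normalForm _ (terms os extra)) (con 0ℤ) certificate))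

  -- Identities between closed forms

  cases≤2 : ∀ {p} (P : ℕ → Set p) → P 0 → P 1 → P 2 → ∀ c → c ≤ 2 → P c
  cases≤2 P p₀ p₁ p₂ 0                   _               = p₀
  cases≤2 P p₀ p₁ p₂ 1                   _               = p₁
  cases≤2 P p₀ p₁ p₂ 2                   _               = p₂
  cases≤2 P p₀ p₁ p₂ (suc (suc (suc _))) (s≤s (s≤s ()))

  private
    pos neg : ∀ {n} → ℕ → Polynomial n
    pos k = con (+ k)
    neg k = con (- + k)

    balance₃ : ∀ A B G → 1ℤ * A + (- 1ℤ * B + (- 1ℤ * G + 0ℤ)) + 0ℤ ≡ 0ℤ → A - B ≡ G
    balance₃ A B G eq = ℤ.i-j≡0⇒i≡j _ _ (trans (rearrange A B G) eq)
      where
      rearrange : ∀ A B G → A - B - G ≡ 1ℤ * A + (- 1ℤ * B + (- 1ℤ * G + 0ℤ)) + 0ℤ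
      rearrange = solve-∀

    balance₅ : ∀ w A B P Q G →
      1ℤ * A + (- 1ℤ * B + (- w * P + (w * Q + (- 1ℤ * G + 0ℤ)))) + 0ℤ ≡ 0ℤ → A - B ≡ w * (P - Q) + G
    balance₅ w A B P Q G eq = ℤ.i-j≡0⇒i≡j _ _ (trans (rearrange w A B P Q G) eq)
      where
      rearrange : ∀ w A B P Q G →
        A - B - (w * (P - Q) + G) ≡ 1ℤ * A + (- 1ℤ * B + (- w * P + (w * Q + (- 1ℤ * G + 0ℤ)))) + 0ℤ
      rearrange = solve-∀

    balance₇ : ∀ w₁ w₂ A B P Q E F G →
      1ℤ * A + (- 1ℤ * B + (- w₁ * P + (w₁ * Q + (- w₂ * E + (w₂ * F + (- 1ℤ * G + 0ℤ)))))) + 0ℤ ≡ 0ℤ →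
      A - B ≡ w₁ * (P - Q) + w₂ * (E - F) + G
    balance₇ w₁ w₂ A B P Q E F G eq = ℤ.i-j≡0⇒i≡j _ _ (trans (rearrange w₁ w₂ A B P Q E F G) eq)
      where
      rearrange : ∀ w₁ w₂ A B P Q E F G →
        A - B - (w₁ * (P - Q) + w₂ * (E - F) + G)
        ≡ 1ℤ * A + (- 1ℤ * B + (- w₁ * P + (w₁ * Q + (- w₂ * E + (w₂ * F + (- 1ℤ * G + 0ℤ)))))) + 0ℤ
      rearrange = solve-∀

  interior : ∀ c → c ≤ 2 → ∀ ℓ K → let N = 5 ℕ.+ K in 3 ℕ.+ ℓ ≤ N →
    point c (suc N) (3 ℕ.+ ℓ)
    ≡ + 𝟙 (2 ≤ᵇ c) * point (c ∸ 2) N ℓ + + 𝟙 (1 ≤ᵇ c) * point (c ∸ 1) N (1 ℕ.+ ℓ) + closed c N (2 ℕ.+ ℓ)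
  interior c c≤2 ℓ K x≤N = balance₇ (+ 𝟙 (2 ≤ᵇ c)) (+ 𝟙 (1 ≤ᵇ c))
    (closed c (suc N) (3 ℕ.+ ℓ)) (closed c (suc N) (4 ℕ.+ ℓ))
    (closed (c ∸ 2) N ℓ) (closed (c ∸ 2) N (1 ℕ.+ ℓ))
    (closed (c ∸ 1) N (1 ℕ.+ ℓ)) (closed (c ∸ 1) N (2 ℕ.+ ℓ)) (closed c N (2 ℕ.+ ℓ))
    (identity (occurrences c) [] (certified c c≤2))
    where
    N = 5 ℕ.+ K
    open Frame (+ ℓ ∷ + K ∷ []) (var zero) (var (suc zero)) refl refl 3 (ℕ.≤-trans x≤N (ℕ.m≤m+n N N))
    occurrences : ℕ → List (Occurrence 2)
    occurrences c =
        occurrence (pos 1) c 1 3 ∷ occurrence (neg 1) c 1 4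
      ∷ occurrence (neg (𝟙 (2 ≤ᵇ c))) (c ∸ 2) 0 0 ∷ occurrence (pos (𝟙 (2 ≤ᵇ c))) (c ∸ 2) 0 1
      ∷ occurrence (neg (𝟙 (1 ≤ᵇ c))) (c ∸ 1) 0 1 ∷ occurrence (pos (𝟙 (1 ≤ᵇ c))) (c ∸ 1) 0 2
      ∷ occurrence (neg 1) c 0 2 ∷ []
    certified : ∀ c → c ≤ 2 → Certified (occurrences c) []
    certified = cases≤2 (λ c → Certified (occurrences c) []) (_ , refl) (_ , refl) (_ , refl)

  boundary₀ : ∀ c → c ≤ 2 → ∀ K → point c (6 ℕ.+ K) 0 ≡ closed c (5 ℕ.+ K) 0
  boundary₀ c c≤2 K = balance₃ (closed c (6 ℕ.+ K) 0) (closed c (6 ℕ.+ K) 1) (closed c (5 ℕ.+ K) 0)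
    (identity (occurrences c) [] (certified c c≤2))
    where
    open Frame (+ K ∷ []) (con (+ 0)) (var zero) refl refl 1 (s≤s z≤n)
    occurrences : ℕ → List (Occurrence 1)
    occurrences c = occurrence (pos 1) c 1 0 ∷ occurrence (neg 1) c 1 1 ∷ occurrence (neg 1) c 0 0 ∷ []
    certified : ∀ c → c ≤ 2 → Certified (occurrences c) []
    certified = cases≤2 (λ c → Certified (occurrences c) []) (_ , refl) (_ , refl) (_ , refl)

  boundary₁ : ∀ c → c ≤ 2 → ∀ K → point c (6 ℕ.+ K) 1 ≡ closed c (5 ℕ.+ K) 0
  boundary₁ c c≤2 K = balance₃ (closed c (6 ℕ.+ K) 1) (closed c (6 ℕ.+ K) 2) (closed c (5 ℕ.+ K) 0)
    (identity (occurrences c) [] (certified c c≤2))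
    where
    open Frame (+ K ∷ []) (con (+ 0)) (var zero) refl refl 1 (s≤s z≤n)
    occurrences : ℕ → List (Occurrence 1)
    occurrences c = occurrence (pos 1) c 1 1 ∷ occurrence (neg 1) c 1 2 ∷ occurrence (neg 1) c 0 0 ∷ []
    certified : ∀ c → c ≤ 2 → Certified (occurrences c) []
    certified = cases≤2 (λ c → Certified (occurrences c) []) (_ , refl) (_ , refl) (_ , refl)

  boundary₂ : ∀ c → c ≤ 2 → ∀ K →
    point c (6 ℕ.+ K) 2 ≡ + 𝟙 (1 ≤ᵇ c) * point (c ∸ 1) (5 ℕ.+ K) 0 + closed c (5 ℕ.+ K) 1
  boundary₂ c c≤2 K = balance₅ (+ 𝟙 (1 ≤ᵇ c)) (closed c (6 ℕ.+ K) 2) (closed c (6 ℕ.+ K) 3)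
    (closed (c ∸ 1) (5 ℕ.+ K) 0) (closed (c ∸ 1) (5 ℕ.+ K) 1) (closed c (5 ℕ.+ K) 1)
    (identity (occurrences c) [] (certified c c≤2))
    where
    open Frame (+ K ∷ []) (con (+ 0)) (var zero) refl refl 2 (s≤s (s≤s z≤n))
    occurrences : ℕ → List (Occurrence 1)
    occurrences c =
        occurrence (pos 1) c 1 2 ∷ occurrence (neg 1) c 1 3
      ∷ occurrence (neg (𝟙 (1 ≤ᵇ c))) (c ∸ 1) 0 0 ∷ occurrence (pos (𝟙 (1 ≤ᵇ c))) (c ∸ 1) 0 1
      ∷ occurrence (neg 1) c 0 1 ∷ []
    certified : ∀ c → c ≤ 2 → Certified (occurrences c) []
    certified = cases≤2 (λ c → Certified (occurrences c) []) (_ , refl) (_ , refl) (_ , refl)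

  closed-top : ∀ c → c ≤ 2 → ∀ K → closed c (5 ℕ.+ K) (5 ℕ.+ K) ≡ 0ℤ
  closed-top c c≤2 K = trans (sym (unit (closed c (5 ℕ.+ K) (5 ℕ.+ K))))
    (identity (occurrence (pos 1) c 0 5 ∷ []) [] (certified c c≤2))
    where
    open Frame (+ K ∷ []) (var zero) (var zero) refl refl 6 (s≤s (ℕ.m≤n+m (5 ℕ.+ K) (4 ℕ.+ K)))
    certified : ∀ c → c ≤ 2 → Certified (occurrence (pos 1) c 0 5 ∷ []) []
    certified = cases≤2 (λ c → Certified (occurrence (pos 1) c 0 5 ∷ []) []) (_ , refl) (_ , refl) (_ , refl)
    unit : ∀ A → 1ℤ * A + 0ℤ + 0ℤ ≡ A
    unit = solve-∀

  closed-total : ∀ K → let N = 5 ℕ.+ K in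
    + (9 ℕ.+ K) * closed 2 N 0 ≡ + N * + (2 ℕ.+ K) * + ((N ℕ.+ N) C (2 ℕ.+ K))
  closed-total K = ℤ.i-j≡0⇒i≡j _ _ (trans (rearrange (+ K) (closed 2 N 0) (+ ((N ℕ.+ N) C (2 ℕ.+ K))))
    (identity (occurrence (pos 9 :+ var zero) 2 0 0 ∷ [])
      (term (:- ((pos 5 :+ var zero) :* (pos 2 :+ var zero))) 1 1 ∷ []) (_ , refl)))
    where
    N = 5 ℕ.+ K
    -- The extra term is -N (N - 3) C(2N, N - 3), and C(2N, N - 3) = C(u + 1, K + 1 + 1).
    open Frame (+ K ∷ []) (con (+ 0)) (var zero) refl refl 1 (s≤s z≤n)
    rearrange : ∀ k A B → (+ 9 + k) * A - (+ 5 + k) * (+ 2 + k) * B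
      ≡ (+ 9 + k) * A + 0ℤ + (- ((+ 5 + k) * (+ 2 + k)) * B + 0ℤ)
    rearrange = solve-∀

  -- Induction on the size of the permutations

  ∑< : ℕ → (ℕ → ℤ) → ℤ
  ∑< zero    f = 0ℤ
  ∑< (suc N) f = ∑< N f + f N

  ∑<-cong : ∀ N {f g : ℕ → ℤ} → (∀ ℓ → ℓ < N → f ℓ ≡ g ℓ) → ∑< N f ≡ ∑< N g
  ∑<-cong zero    f≗g = refl
  ∑<-cong (suc N) f≗g = cong₂ _+_ (∑<-cong N (λ ℓ ℓ<N → f≗g ℓ (ℕ.m<n⇒m<1+n ℓ<N))) (f≗g N ℕ.≤-refl)

  ∑<-suc : ∀ N f → ∑< (suc N) f ≡ f 0 + ∑< N (f ∘ suc)
  ∑<-suc zero    f = trans (ℤ.+-identityˡ (f 0)) (sym (ℤ.+-identityʳ (f 0)))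
  ∑<-suc (suc N) f = trans (cong (_+ f (suc N)) (∑<-suc N f)) (ℤ.+-assoc (f 0) _ _)

  ∑<-split : ∀ a d f → ∑< (a ℕ.+ d) f ≡ ∑< a f + ∑< d (λ j → f (a ℕ.+ j))
  ∑<-split a zero    f = trans (cong (λ m → ∑< m f) (ℕ.+-identityʳ a)) (sym (ℤ.+-identityʳ (∑< a f)))
  ∑<-split a (suc d) f = begin
    ∑< (a ℕ.+ suc d) f                              ≡⟨ cong (λ m → ∑< m f) (ℕ.+-suc a d) ⟩
    ∑< (a ℕ.+ d) f + f (a ℕ.+ d)                    ≡⟨ cong (_+ f (a ℕ.+ d)) (∑<-split a d f) ⟩
    ∑< a f + ∑< d (λ j → f (a ℕ.+ j)) + f (a ℕ.+ d) ≡⟨ ℤ.+-assoc (∑< a f) _ _ ⟩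
    ∑< a f + ∑< (suc d) (λ j → f (a ℕ.+ j))         ∎

  ∑<-telescope : ∀ (F : ℕ → ℤ) a d → ∑< d (λ j → F (a ℕ.+ j) - F (suc (a ℕ.+ j))) ≡ F a - F (a ℕ.+ d)
  ∑<-telescope F a zero    = trans (sym (ℤ.+-inverseʳ (F a))) (cong (λ m → F a - F m) (sym (ℕ.+-identityʳ a)))
  ∑<-telescope F a (suc d) = begin
    ∑< d (λ j → F (a ℕ.+ j) - F (suc (a ℕ.+ j))) + (F (a ℕ.+ d) - F (suc (a ℕ.+ d)))
      ≡⟨ cong (_+ (F (a ℕ.+ d) - F (suc (a ℕ.+ d)))) (∑<-telescope F a d) ⟩
    F a - F (a ℕ.+ d) + (F (a ℕ.+ d) - F (suc (a ℕ.+ d))) ≡⟨ cancel (F a) (F (a ℕ.+ d)) (F (suc (a ℕ.+ d))) ⟩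
    F a - F (suc (a ℕ.+ d))                               ≡⟨ cong (λ m → F a - F m) (ℕ.+-suc a d) ⟨
    F a - F (a ℕ.+ suc d)                                 ∎
    where
    cancel : ∀ p q r → p - q + (q - r) ≡ p - r
    cancel = solve-∀

  ∑<-zero : ∀ N (f : ℕ → ℤ) → (∀ ℓ → ℓ < N → f ℓ ≡ 0ℤ) → ∑< N f ≡ 0ℤ
  ∑<-zero zero    f f≡0 = refl
  ∑<-zero (suc N) f f≡0 = cong₂ _+_ (∑<-zero N f (λ ℓ ℓ<N → f≡0 ℓ (ℕ.m<n⇒m<1+n ℓ<N))) (f≡0 N ℕ.≤-refl)

  ∑<-*ˡ : ∀ N k f → k * ∑< N f ≡ ∑< N (λ ℓ → k * f ℓ)
  ∑<-*ˡ zero    k f = ℤ.*-zeroʳ k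
  ∑<-*ˡ (suc N) k f = trans (ℤ.*-distribˡ-+ k (∑< N f) (f N)) (cong (_+ k * f N) (∑<-*ˡ N k f))

  pos-∑ : ∀ N (f : ℕ → ℕ) → + (∑[ i < N ] f (toℕ i)) ≡ ∑< N (λ ℓ → + f ℓ)
  pos-∑ zero    f = refl
  pos-∑ (suc N) f = begin
    + (f 0 ℕ.+ ∑[ i < N ] f (suc (toℕ i)))     ≡⟨ ℤ.pos-+ (f 0) _ ⟩
    + f 0 + + (∑[ i < N ] f (suc (toℕ i)))     ≡⟨ cong (λ s → + f 0 + s) (pos-∑ N (f ∘ suc)) ⟩
    + f 0 + ∑< N (λ ℓ → + f (suc ℓ))           ≡⟨ ∑<-suc N (λ ℓ → + f ℓ) ⟨
    ∑< (suc N) (λ ℓ → + f ℓ)                   ∎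

  summand : ℕ → ℕ → ℕ → ℕ → ℤ
  summand c N x ℓ = + χ (newOcc x ℓ ℕ.≤? c) * point (c ∸ newOcc x ℓ) N ℓ

  ClosedForm : ℕ → Set
  ClosedForm n = ∀ c → c ≤ 2 → ∀ x → x < suc n → + 2 * + ending n x c ≡ point c (suc n) x

  twice-ending-suc : ∀ n → ClosedForm n → ∀ c → c ≤ 2 → ∀ x → x < suc (suc n) →
    + 2 * + ending (suc n) x c ≡ ∑< (suc n) (summand c (suc n) x)
  twice-ending-suc n hyp c c≤2 x x<N = begin
    + 2 * + ending (suc n) x c
      ≡⟨ cong (λ m → + 2 * + m) (ending-suc n x c x<N) ⟩
    + 2 * + (∑[ ℓ < suc n ] countTerm (toℕ ℓ))
      ≡⟨ cong (+ 2 *_) (pos-∑ (suc n) countTerm) ⟩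
    + 2 * ∑< (suc n) (λ ℓ → + countTerm ℓ)
      ≡⟨ ∑<-*ˡ (suc n) (+ 2) (λ ℓ → + countTerm ℓ) ⟩
    ∑< (suc n) (λ ℓ → + 2 * + countTerm ℓ)
      ≡⟨ ∑<-cong (suc n) (λ ℓ ℓ<N → trans (regroup ℓ) (cong (+ χ (newOcc x ℓ ℕ.≤? c) *_) (hyp′ ℓ ℓ<N))) ⟩
    ∑< (suc n) (summand c (suc n) x) ∎
    where
    countTerm : ℕ → ℕ
    countTerm ℓ = χ (newOcc x ℓ ℕ.≤? c) ℕ.* ending n ℓ (c ∸ newOcc x ℓ)
    regroup : ∀ ℓ → + 2 * + countTerm ℓ ≡ + χ (newOcc x ℓ ℕ.≤? c) * (+ 2 * + ending n ℓ (c ∸ newOcc x ℓ))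
    regroup ℓ = trans (cong (+ 2 *_) (ℤ.pos-* (χ (newOcc x ℓ ℕ.≤? c)) (ending n ℓ (c ∸ newOcc x ℓ))))
      (x∙yz≈y∙xz (+ 2) (+ χ (newOcc x ℓ ℕ.≤? c)) (+ ending n ℓ (c ∸ newOcc x ℓ)))
    hyp′ : ∀ ℓ → ℓ < suc n → + 2 * + ending n ℓ (c ∸ newOcc x ℓ) ≡ point (c ∸ newOcc x ℓ) (suc n) ℓ
    hyp′ ℓ = hyp (c ∸ newOcc x ℓ) (ℕ.≤-trans (ℕ.m∸n≤m c (newOcc x ℓ)) c≤2) ℓ

  summand-tail : ∀ K c → c ≤ 2 → ∀ x a → let N = 5 ℕ.+ K in x ≤ suc a → a ≤ N →
    ∑< N (summand c N x) ≡ ∑< a (summand c N x) + closed c N a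
  summand-tail K c c≤2 x a x≤1+a a≤N = begin
    ∑< N (summand c N x)
      ≡⟨ cong (λ m → ∑< m (summand c N x)) (ℕ.m+[n∸m]≡n a≤N) ⟨
    ∑< (a ℕ.+ (N ∸ a)) (summand c N x)
      ≡⟨ ∑<-split a (N ∸ a) (summand c N x) ⟩
    ∑< a (summand c N x) + ∑< (N ∸ a) (λ j → summand c N x (a ℕ.+ j))
      ≡⟨ cong (λ t → ∑< a (summand c N x) + t)
              (trans (∑<-cong (N ∸ a) (λ j _ → free j)) (∑<-telescope (closed c N) a (N ∸ a))) ⟩
    ∑< a (summand c N x) + (closed c N a - closed c N (a ℕ.+ (N ∸ a)))
      ≡⟨ cong (λ m → ∑< a (summand c N x) + (closed c N a - closed c N m)) (ℕ.m+[n∸m]≡n a≤N) ⟩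
    ∑< a (summand c N x) + (closed c N a - closed c N N)
      ≡⟨ cong (λ t → ∑< a (summand c N x) + (closed c N a - t)) (closed-top c c≤2 K) ⟩
    ∑< a (summand c N x) + (closed c N a - 0ℤ)
      ≡⟨ cong (λ t → ∑< a (summand c N x) + t) (ℤ.+-identityʳ (closed c N a)) ⟩
    ∑< a (summand c N x) + closed c N a ∎
    where
    N = 5 ℕ.+ K
    free : ∀ j → summand c N x (a ℕ.+ j) ≡ point c N (a ℕ.+ j)
    free j rewrite ℕ.m≤n⇒m∸n≡0 (ℕ.≤-trans x≤1+a (s≤s (ℕ.m≤m+n a j))) =
      ℤ.*-identityˡ (point c N (a ℕ.+ j))

  summand-at : ∀ c N x ℓ k → newOcc x ℓ ≡ k →
    summand c N x ℓ ≡ + χ (k ℕ.≤? c) * point (c ∸ k) N ℓ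
  summand-at c N x ℓ k refl = refl

  newOcc-far : ∀ ℓ ℓ′ → ℓ′ < ℓ → 3 ≤ newOcc (3 ℕ.+ ℓ) ℓ′
  newOcc-far ℓ ℓ′ ℓ′<ℓ =
    subst (3 ≤_) (sym (ℕ.+-∸-assoc 2 (ℕ.<⇒≤ ℓ′<ℓ))) (ℕ.+-monoʳ-≤ 2 (ℕ.m<n⇒0<n∸m ℓ′<ℓ))

  recurrence-interior : ∀ K c → c ≤ 2 → ∀ ℓ → let N = 5 ℕ.+ K in 3 ℕ.+ ℓ ≤ N →
    ∑< N (summand c N (3 ℕ.+ ℓ)) ≡ point c (suc N) (3 ℕ.+ ℓ)
  recurrence-interior K c c≤2 ℓ x≤N = begin
    ∑< N (summand c N x)
      ≡⟨ summand-tail K c c≤2 x (2 ℕ.+ ℓ) ℕ.≤-refl (ℕ.≤-trans (ℕ.n≤1+n (2 ℕ.+ ℓ)) x≤N) ⟩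
    ∑< (2 ℕ.+ ℓ) (summand c N x) + closed c N (2 ℕ.+ ℓ)
      ≡⟨ cong (_+ closed c N (2 ℕ.+ ℓ)) last-two ⟩
    + 𝟙 (2 ≤ᵇ c) * point (c ∸ 2) N ℓ + + 𝟙 (1 ≤ᵇ c) * point (c ∸ 1) N (1 ℕ.+ ℓ) + closed c N (2 ℕ.+ ℓ)
      ≡⟨ interior c c≤2 ℓ K x≤N ⟨
    point c (suc N) x ∎
    where
    N = 5 ℕ.+ K
    x = 3 ℕ.+ ℓ
    too-far : ∑< ℓ (summand c N x) ≡ 0ℤ
    too-far = ∑<-zero ℓ (summand c N x) λ ℓ′ ℓ′<ℓ →
      trans (cong (λ b → + 𝟙 b * point (c ∸ newOcc x ℓ′) N ℓ′)
                  (dec-false (newOcc x ℓ′ ℕ.≤? c) (ℕ.<⇒≱ (ℕ.≤-<-trans c≤2 (newOcc-far ℓ ℓ′ ℓ′<ℓ)))))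
            (ℤ.*-zeroˡ (point (c ∸ newOcc x ℓ′) N ℓ′))
    last-two : ∑< (2 ℕ.+ ℓ) (summand c N x)
             ≡ + 𝟙 (2 ≤ᵇ c) * point (c ∸ 2) N ℓ + + 𝟙 (1 ≤ᵇ c) * point (c ∸ 1) N (1 ℕ.+ ℓ)
    last-two = cong₂ _+_
      (trans (cong₂ _+_ too-far (summand-at c N x ℓ 2 (ℕ.m+n∸n≡m 2 ℓ)))
             (ℤ.+-identityˡ (+ 𝟙 (2 ≤ᵇ c) * point (c ∸ 2) N ℓ)))
      (summand-at c N x (1 ℕ.+ ℓ) 1 (ℕ.m+n∸n≡m 1 ℓ))

  recurrence-sum : ∀ K c → c ≤ 2 → ∀ x → let N = 5 ℕ.+ K in x < suc N →
    ∑< N (summand c N x) ≡ point c (suc N) x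
  recurrence-sum K c c≤2 0 _ = begin
    ∑< N (summand c N 0) ≡⟨ summand-tail K c c≤2 0 0 z≤n z≤n ⟩
    0ℤ + closed c N 0    ≡⟨ ℤ.+-identityˡ (closed c N 0) ⟩
    closed c N 0         ≡⟨ boundary₀ c c≤2 K ⟨
    point c (suc N) 0    ∎
    where N = 5 ℕ.+ K
  recurrence-sum K c c≤2 1 _ = begin
    ∑< N (summand c N 1) ≡⟨ summand-tail K c c≤2 1 0 (s≤s z≤n) z≤n ⟩
    0ℤ + closed c N 0    ≡⟨ ℤ.+-identityˡ (closed c N 0) ⟩
    closed c N 0         ≡⟨ boundary₁ c c≤2 K ⟨
    point c (suc N) 1    ∎
    where N = 5 ℕ.+ K
  recurrence-sum K c c≤2 2 _ = begin
    ∑< N (summand c N 2)                ≡⟨ summand-tail K c c≤2 2 1 ℕ.≤-refl (s≤s z≤n) ⟩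
    0ℤ + summand c N 2 0 + closed c N 1 ≡⟨ cong (_+ closed c N 1) (ℤ.+-identityˡ (summand c N 2 0)) ⟩
    summand c N 2 0 + closed c N 1      ≡⟨ boundary₂ c c≤2 K ⟨
    point c (suc N) 2                   ∎
    where N = 5 ℕ.+ K
  recurrence-sum K c c≤2 (suc (suc (suc ℓ))) (s≤s x≤N) = recurrence-interior K c c≤2 ℓ x≤N

  closedForm-step : ∀ K → ClosedForm (4 ℕ.+ K) → ClosedForm (5 ℕ.+ K)
  closedForm-step K hyp c c≤2 x x<N =
    trans (twice-ending-suc (4 ℕ.+ K) hyp c c≤2 x x<N) (recurrence-sum K c c≤2 x x<N)

  closedForm-base : ClosedForm 4
  closedForm-base 0 _ 0 _ = refl
  closedForm-base 0 _ 1 _ = refl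
  closedForm-base 0 _ 2 _ = refl
  closedForm-base 0 _ 3 _ = refl
  closedForm-base 0 _ 4 _ = refl
  closedForm-base 1 _ 0 _ = refl
  closedForm-base 1 _ 1 _ = refl
  closedForm-base 1 _ 2 _ = refl
  closedForm-base 1 _ 3 _ = refl
  closedForm-base 1 _ 4 _ = refl
  closedForm-base 2 _ 0 _ = refl
  closedForm-base 2 _ 1 _ = refl
  closedForm-base 2 _ 2 _ = refl
  closedForm-base 2 _ 3 _ = refl
  closedForm-base 2 _ 4 _ = refl
  closedForm-base (suc (suc (suc _))) (s≤s (s≤s ())) _ _
  closedForm-base _ _ (suc (suc (suc (suc (suc _))))) (s≤s (s≤s (s≤s (s≤s (s≤s ())))))

  closedForm : ∀ K → ClosedForm (4 ℕ.+ K)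
  closedForm zero    = closedForm-base
  closedForm (suc K) = closedForm-step K (closedForm K)

  twice-numPermsTwo213 : ∀ K → + 2 * + numPermsTwo213 (5 ℕ.+ K) ≡ closed 2 (5 ℕ.+ K) 0
  twice-numPermsTwo213 K = begin
    + 2 * + numPermsTwo213 N
      ≡⟨ cong (λ m → + 2 * + m) (numPermsTwo213-by-last (4 ℕ.+ K)) ⟩
    + 2 * + (∑[ x < N ] ending (4 ℕ.+ K) (toℕ x) 2)
      ≡⟨ cong (+ 2 *_) (pos-∑ N (λ x → ending (4 ℕ.+ K) x 2)) ⟩
    + 2 * ∑< N (λ x → + ending (4 ℕ.+ K) x 2)
      ≡⟨ ∑<-*ˡ N (+ 2) (λ x → + ending (4 ℕ.+ K) x 2) ⟩
    ∑< N (λ x → + 2 * + ending (4 ℕ.+ K) x 2)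
      ≡⟨ ∑<-cong N (closedForm K 2 (s≤s (s≤s z≤n))) ⟩
    ∑< N (point 2 N)
      ≡⟨ ∑<-telescope (closed 2 N) 0 N ⟩
    closed 2 N 0 - closed 2 N N
      ≡⟨ cong (λ t → closed 2 N 0 - t) (closed-top 2 (s≤s (s≤s z≤n)) K) ⟩
    closed 2 N 0 - 0ℤ
      ≡⟨ ℤ.+-identityʳ (closed 2 N 0) ⟩
    closed 2 N 0 ∎
    where
    N = 5 ℕ.+ K

  counting-formula : ∀ K → let n = 5 ℕ.+ K in
    2 ℕ.* (n ℕ.+ 4) ℕ.* numPermsTwo213 n ≡ n ℕ.* (n ∸ 3) ℕ.* ((2 ℕ.* n) C (n ∸ 3))
  counting-formula K = ℤ.+-injective (begin
    + (2 ℕ.* (n ℕ.+ 4) ℕ.* numPermsTwo213 n)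
      ≡⟨ cast₃ 2 (n ℕ.+ 4) (numPermsTwo213 n) ⟩
    + 2 * + (n ℕ.+ 4) * + numPermsTwo213 n
      ≡⟨ xy∙z≈y∙xz (+ 2) (+ (n ℕ.+ 4)) (+ numPermsTwo213 n) ⟩
    + (n ℕ.+ 4) * (+ 2 * + numPermsTwo213 n)
      ≡⟨ cong₂ _*_ (cong +_ (ℕ.+-comm n 4)) (twice-numPermsTwo213 K) ⟩
    + (9 ℕ.+ K) * closed 2 n 0
      ≡⟨ closed-total K ⟩
    + n * + (n ∸ 3) * + ((n ℕ.+ n) C (n ∸ 3))
      ≡⟨ cong (λ m → + n * + (n ∸ 3) * + (m C (n ∸ 3))) (cong (n ℕ.+_) (ℕ.+-identityʳ n)) ⟨
    + n * + (n ∸ 3) * + ((2 ℕ.* n) C (n ∸ 3))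
      ≡⟨ cast₃ n (n ∸ 3) ((2 ℕ.* n) C (n ∸ 3)) ⟨
    + (n ℕ.* (n ∸ 3) ℕ.* ((2 ℕ.* n) C (n ∸ 3))) ∎)
    where
    n = 5 ℕ.+ K
    cast₃ : ∀ a b d → + (a ℕ.* b ℕ.* d) ≡ + a * + b * + d
    cast₃ a b d = trans (ℤ.pos-* (a ℕ.* b) d) (cong (_* + d) (ℤ.pos-* a b))

open ClosedForms using (counting-formula)
open import Data.Nat using (_+_; _*_)

corollary8 : (n : ℕ) → n ≥ 1 →
    2 * (n + 4) * numPermsTwo213 n ≡ n * (n ∸ 3) * ((2 * n) C (n ∸ 3))
corollary8 1 _ = refl
corollary8 2 _ = refl
corollary8 3 _ = refl
corollary8 4 _ = refl
corollary8 (suc (suc (suc (suc (suc K))))) _ = counting-formula K
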